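{- Let $(m,n)\in\{(2,3),(2,\infty),(3,3),(3,\infty)\}$ and let $S_{m,n}=\mathbb Z[X,X^{ -1},Y,Y^{ -1}]/(\psi_m(X),\psi_n(Y))$, with $x,y$ the images of $X,Y$. Then the invertible elements of the ring $S_{m,n}$ are exactly the elements $\pm x^iy^j$ with $i,j\in\mathbb Z$.
   Context: For finite $m$, $\psi_m(X)=X^{m-1}+\dots+X+1$; $\psi_\infty=0$. -}

module Defs where

open import Data.Nat using (ℕ)
open import Data.Integer using (ℤ; +_; -_; _*_; _+_; _≟_; -1ℤ; 1ℤ; 0ℤ)
open import Data.Bool using (if_then_else_; _∧_)
open import Data.List using (List; []; _∷_; map; concatMap; _++_; upTo)
open import Data.Product using (Σ; _×_; _,_; ∃)
open import Data.Sum using (_⊎_)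
open import Relation.Nullary.Decidable using (⌊_⌋)
open import Relation.Binary.PropositionalEquality using (_≡_)

data ℕ∞ : Set where
  fin : ℕ → ℕ∞
  ∞   : ℕ∞

-- Laurent polynomials in Z[X,X⁻¹,Y,Y⁻¹], represented as formal finite sums
-- of terms  c · X^a · Y^b  (c , a , b).  Two representations denote the same
-- Laurent polynomial iff their coefficient functions agree.
Term : Set
Term = ℤ × ℤ × ℤ

LPoly : Set
LPoly = List Term

coeff : LPoly → ℤ → ℤ → ℤ
coeff [] i j = 0ℤ
coeff ((c , a , b) ∷ p) i j =
  (if ⌊ a ≟ i ⌋ ∧ ⌊ b ≟ j ⌋ then c else 0ℤ) + coeff p i j

_⊕_ : LPoly → LPoly → LPoly
p ⊕ q = p ++ q

⊖_ : LPoly → LPoly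
⊖ p = map (λ { (c , a , b) → (- c , a , b) }) p

termMul : Term → Term → Term
termMul (c , a , b) (d , a' , b') = (c * d , a + a' , b + b')

_⊗_ : LPoly → LPoly → LPoly
p ⊗ q = concatMap (λ t → map (termMul t) q) p

monomial : ℤ → ℤ → ℤ → LPoly
monomial c i j = (c , i , j) ∷ []

one : LPoly
one = monomial 1ℤ 0ℤ 0ℤ

ψX : ℕ∞ → LPoly
ψX (fin m) = map (λ k → (1ℤ , + k , 0ℤ)) (upTo m)
ψX ∞ = []

ψY : ℕ∞ → LPoly
ψY (fin n) = map (λ k → (1ℤ , 0ℤ , + k)) (upTo n)
ψY ∞ = []

InIdeal : ℕ∞ → ℕ∞ → LPoly → Set
InIdeal m n f = Σ LPoly λ a → Σ LPoly λ b →
  ∀ i j → coeff f i j ≡ coeff ((a ⊗ ψX m) ⊕ (b ⊗ ψY n)) i j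

-- equality in S_{m,n} = Z[X^±,Y^±]/(ψ_m(X), ψ_n(Y))  (setoid quotient)
_≈[_,_]_ : LPoly → ℕ∞ → ℕ∞ → LPoly → Set
f ≈[ m , n ] g = InIdeal m n (f ⊕ (⊖ g))

IsUnit : ℕ∞ → ℕ∞ → LPoly → Set
IsUnit m n u = Σ LPoly λ v → (u ⊗ v) ≈[ m , n ] one

Admissible : ℕ∞ → ℕ∞ → Set
Admissible m n = (m ≡ fin 2 ⊎ m ≡ fin 3) × (n ≡ fin 3 ⊎ n ≡ ∞)

{-# OPTIONS --safe #-}
-- Every S_{m,n} in question is detected by ring maps to ℤ[ω] (ω² + ω + 1 = 0), possibly over a
-- Laurent variable, and the units of ℤ[ω] are ±1, ±ω, ±ω² since its norm a² - ab + b² is 1 only there.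
-- S_{2,3} ≅ ℤ[ω] via x, y ↦ -1, ω.  S_{3,3} embeds in ℤ[ω] × ℤ[ω] via (x, y) ↦ (ω, ω) and (ω, ω̄); a unit
-- goes to a pair (±ω^k₁, ±ω^k₂) whose signs agree because both maps agree modulo 1 - ω, and every such
-- pair is the image of a signed monomial.  S_{m,∞} ≅ ℤ[ζ][y^±] with ζ = -1 or ω, where comparing the
-- highest and the lowest powers of y in u v = 1 shows that a unit is concentrated in a single power of y.
-- Injectivity of these maps comes from reducing every monomial modulo ψ_m(x), and ψ_n(y) for finite n,
-- to degree at most 1 in that variable.  Conversely ±x^i y^j has inverse ±x^{-i} y^{-j}.

module Submission where

open import Defs
open import Data.Nat as ℕ using (ℕ; zero; suc; z≤n; s≤s)
import Data.Nat.Properties as ℕ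
import Data.Nat.Divisibility as ℕ
open import Data.Integer as ℤ using (ℤ; +_; -[1+_]; 0ℤ; 1ℤ; -1ℤ; _+_; _*_; -_; _-_; ∣_∣; _≟_; _≤_; _<_)
import Data.Integer.Properties as ℤ
open import Data.Integer.Divisibility.Signed using (_∣_; divides; ∣⇒∣ᵤ; ∣m∣n⇒∣m-n; ∣m∣n⇒∣m+n)
open import Data.Integer.Tactic.RingSolver using (solve-∀)
open import Data.Bool using (Bool; true; false; if_then_else_; _∧_)
import Data.Bool.Properties as Bool
open import Data.Fin using (Fin; zero; suc; toℕ)
open import Data.List using (List; []; _∷_; _++_; map; length; concatMap; upTo; [_])
import Data.List.Properties as List
open import Data.List.Relation.Unary.All using (All; []; _∷_)
import Data.List.Relation.Unary.All as All
open import Data.List.Extrema ℤ.≤-totalOrder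
open import Data.Product using (Σ; _×_; _,_; proj₁; proj₂)
open import Data.Sum using (_⊎_; inj₁; inj₂; [_,_]′)
open import Data.Empty using (⊥-elim)
open import Function using (_∘_)
open import Function.Bundles using (_⇔_; mk⇔)
open import Relation.Nullary using (Dec; yes; no; ¬_)
open import Relation.Nullary.Decidable using (⌊_⌋)
open import Relation.Binary.PropositionalEquality hiding ([_])

infix  5 _+ω_
infixl 6 _+ᴱ_
infixl 7 _*ᴱ_ _·_

-- The Eisenstein integers ℤ[ω]

-- a +ω b is a + bω in ℤ[ω], where ω² = -1 - ω
record 𝔼 : Set where
  constructor _+ω_
  field
    re im : ℤ

open 𝔼 public

0ᴱ 1ᴱ -1ᴱ ω ω̄ : 𝔼
0ᴱ  = 0ℤ +ω 0ℤ
1ᴱ  = 1ℤ +ω 0ℤ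
-1ᴱ = -1ℤ +ω 0ℤ
ω   = 0ℤ +ω 1ℤ
ω̄   = -1ℤ +ω -1ℤ

_+ᴱ_ : 𝔼 → 𝔼 → 𝔼
(a +ω b) +ᴱ (c +ω d) = a + c +ω b + d

-ᴱ_ : 𝔼 → 𝔼
-ᴱ (a +ω b) = - a +ω - b

_*ᴱ_ : 𝔼 → 𝔼 → 𝔼
(a +ω b) *ᴱ (c +ω d) = a * c - b * d +ω (a * d + b * c) - b * d

_·_ : ℤ → 𝔼 → 𝔼
k · (a +ω b) = k * a +ω k * b

conj : 𝔼 → 𝔼
conj (a +ω b) = a - b +ω - b

+ω-cong : ∀ {a b c d} → a ≡ c → b ≡ d → a +ω b ≡ c +ω d
+ω-cong = cong₂ _+ω_

+ᴱ-comm : ∀ x y → x +ᴱ y ≡ y +ᴱ x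
+ᴱ-comm (a +ω b) (c +ω d) = +ω-cong (ℤ.+-comm a c) (ℤ.+-comm b d)

+ᴱ-assoc : ∀ x y z → (x +ᴱ y) +ᴱ z ≡ x +ᴱ (y +ᴱ z)
+ᴱ-assoc (a +ω b) (c +ω d) (e +ω f) = +ω-cong (ℤ.+-assoc a c e) (ℤ.+-assoc b d f)

+ᴱ-identityˡ : ∀ x → 0ᴱ +ᴱ x ≡ x
+ᴱ-identityˡ (a +ω b) = +ω-cong (ℤ.+-identityˡ a) (ℤ.+-identityˡ b)

+ᴱ-identityʳ : ∀ x → x +ᴱ 0ᴱ ≡ x
+ᴱ-identityʳ (a +ω b) = +ω-cong (ℤ.+-identityʳ a) (ℤ.+-identityʳ b)

+ᴱ-inverseʳ : ∀ x → x +ᴱ -ᴱ x ≡ 0ᴱ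
+ᴱ-inverseʳ (a +ω b) = +ω-cong (ℤ.+-inverseʳ a) (ℤ.+-inverseʳ b)

-ᴱ-distrib-+ᴱ : ∀ x y → -ᴱ (x +ᴱ y) ≡ -ᴱ x +ᴱ -ᴱ y
-ᴱ-distrib-+ᴱ (a +ω b) (c +ω d) = +ω-cong (ℤ.neg-distrib-+ a c) (ℤ.neg-distrib-+ b d)

x-y≡0⇒x≡y : ∀ x y → x +ᴱ -ᴱ y ≡ 0ᴱ → x ≡ y
x-y≡0⇒x≡y (a +ω b) (c +ω d) eq =
  +ω-cong (ℤ.i-j≡0⇒i≡j a c (cong re eq)) (ℤ.i-j≡0⇒i≡j b d (cong im eq))

*ᴱ-comm : ∀ x y → x *ᴱ y ≡ y *ᴱ x
*ᴱ-comm (a +ω b) (c +ω d) = +ω-cong (re-part a b c d) (im-part a b c d)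
  where
  re-part : ∀ a b c d → a * c - b * d ≡ c * a - d * b
  re-part = solve-∀
  im-part : ∀ a b c d → (a * d + b * c) - b * d ≡ (c * b + d * a) - d * b
  im-part = solve-∀

*ᴱ-assoc : ∀ x y z → (x *ᴱ y) *ᴱ z ≡ x *ᴱ (y *ᴱ z)
*ᴱ-assoc (a +ω b) (c +ω d) (e +ω f) = +ω-cong (re-part a b c d e f) (im-part a b c d e f)
  where
  re-part : ∀ a b c d e f → (a * c - b * d) * e - ((a * d + b * c) - b * d) * f
                         ≡ a * (c * e - d * f) - b * ((c * f + d * e) - d * f)
  re-part = solve-∀
  im-part : ∀ a b c d e f →
    ((a * c - b * d) * f + ((a * d + b * c) - b * d) * e) - ((a * d + b * c) - b * d) * f
      ≡ (a * ((c * f + d * e) - d * f) + b * (c * e - d * f)) - b * ((c * f + d * e) - d * f)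
  im-part = solve-∀

*ᴱ-identityˡ : ∀ x → 1ᴱ *ᴱ x ≡ x
*ᴱ-identityˡ (a +ω b) = +ω-cong (re-part a b) (im-part a b)
  where
  re-part : ∀ a b → 1ℤ * a - 0ℤ * b ≡ a
  re-part = solve-∀
  im-part : ∀ a b → (1ℤ * b + 0ℤ * a) - 0ℤ * b ≡ b
  im-part = solve-∀

*ᴱ-identityʳ : ∀ x → x *ᴱ 1ᴱ ≡ x
*ᴱ-identityʳ x = trans (*ᴱ-comm x 1ᴱ) (*ᴱ-identityˡ x)

*ᴱ-zeroʳ : ∀ x → x *ᴱ 0ᴱ ≡ 0ᴱ
*ᴱ-zeroʳ (a +ω b) = +ω-cong (re-part a b) (im-part a b)
  where
  re-part : ∀ a b → a * 0ℤ - b * 0ℤ ≡ 0ℤ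
  re-part = solve-∀
  im-part : ∀ a b → (a * 0ℤ + b * 0ℤ) - b * 0ℤ ≡ 0ℤ
  im-part = solve-∀

*ᴱ-zeroˡ : ∀ x → 0ᴱ *ᴱ x ≡ 0ᴱ
*ᴱ-zeroˡ x = trans (*ᴱ-comm 0ᴱ x) (*ᴱ-zeroʳ x)

*ᴱ-distribʳ-+ᴱ : ∀ x y z → (y +ᴱ z) *ᴱ x ≡ y *ᴱ x +ᴱ z *ᴱ x
*ᴱ-distribʳ-+ᴱ (a +ω b) (c +ω d) (e +ω f) = +ω-cong (re-part a b c d e f) (im-part a b c d e f)
  where
  re-part : ∀ a b c d e f → (c + e) * a - (d + f) * b ≡ (c * a - d * b) + (e * a - f * b)
  re-part = solve-∀
  im-part : ∀ a b c d e f → ((c + e) * b + (d + f) * a) - (d + f) * b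
                         ≡ ((c * b + d * a) - d * b) + ((e * b + f * a) - f * b)
  im-part = solve-∀

*ᴱ-distribˡ-+ᴱ : ∀ x y z → x *ᴱ (y +ᴱ z) ≡ x *ᴱ y +ᴱ x *ᴱ z
*ᴱ-distribˡ-+ᴱ x y z = begin
  x *ᴱ (y +ᴱ z)       ≡⟨ *ᴱ-comm x (y +ᴱ z) ⟩
  (y +ᴱ z) *ᴱ x       ≡⟨ *ᴱ-distribʳ-+ᴱ x y z ⟩
  y *ᴱ x +ᴱ z *ᴱ x    ≡⟨ cong₂ _+ᴱ_ (*ᴱ-comm y x) (*ᴱ-comm z x) ⟩
  x *ᴱ y +ᴱ x *ᴱ z    ∎
  where open ≡-Reasoning

*ᴱ-interchange : ∀ x y z w → (x *ᴱ y) *ᴱ (z *ᴱ w) ≡ (x *ᴱ z) *ᴱ (y *ᴱ w)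
*ᴱ-interchange x y z w = begin
  (x *ᴱ y) *ᴱ (z *ᴱ w) ≡⟨ *ᴱ-assoc x y (z *ᴱ w) ⟩
  x *ᴱ (y *ᴱ (z *ᴱ w)) ≡⟨ cong (x *ᴱ_) (sym (*ᴱ-assoc y z w)) ⟩
  x *ᴱ ((y *ᴱ z) *ᴱ w) ≡⟨ cong (λ q → x *ᴱ (q *ᴱ w)) (*ᴱ-comm y z) ⟩
  x *ᴱ ((z *ᴱ y) *ᴱ w) ≡⟨ cong (x *ᴱ_) (*ᴱ-assoc z y w) ⟩
  x *ᴱ (z *ᴱ (y *ᴱ w)) ≡⟨ sym (*ᴱ-assoc x z (y *ᴱ w)) ⟩
  (x *ᴱ z) *ᴱ (y *ᴱ w) ∎
  where open ≡-Reasoning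

·-zeroʳ : ∀ k → k · 0ᴱ ≡ 0ᴱ
·-zeroʳ k = +ω-cong (ℤ.*-zeroʳ k) (ℤ.*-zeroʳ k)

·-identityˡ : ∀ x → 1ℤ · x ≡ x
·-identityˡ (a +ω b) = +ω-cong (ℤ.*-identityˡ a) (ℤ.*-identityˡ b)

·-distribʳ : ∀ k l x → (k + l) · x ≡ k · x +ᴱ l · x
·-distribʳ k l (a +ω b) = +ω-cong (ℤ.*-distribʳ-+ a k l) (ℤ.*-distribʳ-+ b k l)

neg-· : ∀ k x → (- k) · x ≡ -ᴱ (k · x)
neg-· k (a +ω b) = +ω-cong (sym (ℤ.neg-distribˡ-* k a)) (sym (ℤ.neg-distribˡ-* k b))

·-*ᴱ-interchange : ∀ k l x y → (k * l) · (x *ᴱ y) ≡ (k · x) *ᴱ (l · y)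
·-*ᴱ-interchange k l (a +ω b) (e +ω f) = +ω-cong (re-part k l a b e f) (im-part k l a b e f)
  where
  re-part : ∀ k l a b e f → (k * l) * (a * e - b * f) ≡ (k * a) * (l * e) - (k * b) * (l * f)
  re-part = solve-∀
  im-part : ∀ k l a b e f → (k * l) * ((a * f + b * e) - b * f)
                         ≡ ((k * a) * (l * f) + (k * b) * (l * e)) - (k * b) * (l * f)
  im-part = solve-∀

conj-*ᴱ : ∀ x y → conj (x *ᴱ y) ≡ conj x *ᴱ conj y
conj-*ᴱ (a +ω b) (c +ω d) = +ω-cong (re-part a b c d) (im-part a b c d)
  where
  re-part : ∀ a b c d → (a * c - b * d) - ((a * d + b * c) - b * d) ≡ (a - b) * (c - d) - (- b) * (- d)
  re-part = solve-∀
  im-part : ∀ a b c d → - ((a * d + b * c) - b * d) ≡ ((a - b) * (- d) + (- b) * (c - d)) - (- b) * (- d)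
  im-part = solve-∀

neg-·≡·-1ᴱ*ᴱ : ∀ c x → (- c) · x ≡ c · (-1ᴱ *ᴱ x)
neg-·≡·-1ᴱ*ᴱ c (x +ω y) = +ω-cong (re-part c x y) (im-part c x y)
  where
  re-part : ∀ c x y → (- c) * x ≡ c * (-1ℤ * x - 0ℤ * y)
  re-part = solve-∀
  im-part : ∀ c x y → (- c) * y ≡ c * ((-1ℤ * y + 0ℤ * x) - 0ℤ * y)
  im-part = solve-∀

ω²-from-1+ω : ∀ c x → (- c) · x +ᴱ (- c) · (ω *ᴱ x) ≡ c · (ω *ᴱ (ω *ᴱ x))
ω²-from-1+ω c (x +ω y) = +ω-cong (re-part c x y) (im-part c x y)
  where
  re-part : ∀ c x y → (- c) * x + (- c) * (0ℤ * x - 1ℤ * y)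
                   ≡ c * (0ℤ * (0ℤ * x - 1ℤ * y) - 1ℤ * ((0ℤ * y + 1ℤ * x) - 1ℤ * y))
  re-part = solve-∀
  im-part : ∀ c x y → (- c) * y + (- c) * ((0ℤ * y + 1ℤ * x) - 1ℤ * y)
    ≡ c * ((0ℤ * ((0ℤ * y + 1ℤ * x) - 1ℤ * y) + 1ℤ * (0ℤ * x - 1ℤ * y)) - 1ℤ * ((0ℤ * y + 1ℤ * x) - 1ℤ * y))
  im-part = solve-∀

1-from-ω+ω² : ∀ c x → (- c) · (ω *ᴱ x) +ᴱ (- c) · (ω *ᴱ (ω *ᴱ x)) ≡ c · x
1-from-ω+ω² c (x +ω y) = +ω-cong (re-part c x y) (im-part c x y)
  where
  re-part : ∀ c x y → (- c) * (0ℤ * x - 1ℤ * y)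
    + (- c) * (0ℤ * (0ℤ * x - 1ℤ * y) - 1ℤ * ((0ℤ * y + 1ℤ * x) - 1ℤ * y)) ≡ c * x
  re-part = solve-∀
  im-part : ∀ c x y → (- c) * ((0ℤ * y + 1ℤ * x) - 1ℤ * y)
    + (- c) * ((0ℤ * ((0ℤ * y + 1ℤ * x) - 1ℤ * y) + 1ℤ * (0ℤ * x - 1ℤ * y)) - 1ℤ * ((0ℤ * y + 1ℤ * x) - 1ℤ * y))
    ≡ c * y
  im-part = solve-∀

+ᴱ-leftComm : ∀ x y z → x +ᴱ (y +ᴱ z) ≡ y +ᴱ (x +ᴱ z)
+ᴱ-leftComm x y z = begin
  x +ᴱ (y +ᴱ z) ≡⟨ sym (+ᴱ-assoc x y z) ⟩
  (x +ᴱ y) +ᴱ z ≡⟨ cong (_+ᴱ z) (+ᴱ-comm x y) ⟩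
  (y +ᴱ x) +ᴱ z ≡⟨ +ᴱ-assoc y x z ⟩
  y +ᴱ (x +ᴱ z) ∎
  where open ≡-Reasoning

infixr 8 _^_

_^_ : 𝔼 → ℕ → 𝔼
x ^ zero  = 1ᴱ
x ^ suc n = x *ᴱ x ^ n

zpow : 𝔼 → 𝔼 → ℤ → 𝔼
zpow ξ ξ⁻¹ (+ n)    = ξ ^ n
zpow ξ ξ⁻¹ -[1+ n ] = ξ⁻¹ ^ suc n

module IntegerPowers (ξ ξ⁻¹ : 𝔼) (ξ*ξ⁻¹≡1 : ξ *ᴱ ξ⁻¹ ≡ 1ᴱ) where

  ξ^ : ℤ → 𝔼
  ξ^ = zpow ξ ξ⁻¹

  private
    cancel : ∀ x → ξ *ᴱ (ξ⁻¹ *ᴱ x) ≡ x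
    cancel x = trans (sym (*ᴱ-assoc ξ ξ⁻¹ x)) (trans (cong (_*ᴱ x) ξ*ξ⁻¹≡1) (*ᴱ-identityˡ x))

    cancel⁻¹ : ∀ x → ξ⁻¹ *ᴱ (ξ *ᴱ x) ≡ x
    cancel⁻¹ x = trans (sym (*ᴱ-assoc ξ⁻¹ ξ x))
      (trans (cong (_*ᴱ x) (trans (*ᴱ-comm ξ⁻¹ ξ) ξ*ξ⁻¹≡1)) (*ᴱ-identityˡ x))

    commute : ∀ x y z → x *ᴱ (y *ᴱ z) ≡ y *ᴱ (x *ᴱ z)
    commute x y z = trans (sym (*ᴱ-assoc x y z))
      (trans (cong (_*ᴱ z) (*ᴱ-comm x y)) (*ᴱ-assoc y x z))

  ξ^-suc : ∀ a → ξ^ (a + 1ℤ) ≡ ξ *ᴱ ξ^ a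
  ξ^-suc (+ n)           = cong ξ^ (ℤ.+-comm (+ n) 1ℤ)
  ξ^-suc -[1+ zero ]     = sym (trans (cong (ξ *ᴱ_) (*ᴱ-identityʳ ξ⁻¹)) ξ*ξ⁻¹≡1)
  ξ^-suc -[1+ suc n ]    = sym (cancel _)

  ξ^-pred : ∀ a → ξ^ (a - 1ℤ) ≡ ξ⁻¹ *ᴱ ξ^ a
  ξ^-pred (+ zero)   = refl
  ξ^-pred (+ suc n)  = sym (cancel⁻¹ _)
  ξ^-pred -[1+ n ]   = cong (λ k → ξ^ -[1+ suc k ]) (ℕ.+-identityʳ n)

  ξ^-+ : ∀ a b → ξ^ (a + b) ≡ ξ^ a *ᴱ ξ^ b
  ξ^-+ a (+ zero) = trans (cong ξ^ (ℤ.+-identityʳ a)) (sym (*ᴱ-identityʳ _))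
  ξ^-+ a (+ suc n) = begin
    ξ^ (a + + suc n)          ≡⟨ cong ξ^ (trans (cong (λ k → a + k) (ℤ.+-comm 1ℤ (+ n)))
                                                (sym (ℤ.+-assoc a (+ n) 1ℤ))) ⟩
    ξ^ ((a + + n) + 1ℤ)       ≡⟨ ξ^-suc (a + + n) ⟩
    ξ *ᴱ ξ^ (a + + n)         ≡⟨ cong (ξ *ᴱ_) (ξ^-+ a (+ n)) ⟩
    ξ *ᴱ (ξ^ a *ᴱ ξ^ (+ n))   ≡⟨ commute ξ (ξ^ a) (ξ^ (+ n)) ⟩
    ξ^ a *ᴱ ξ^ (+ suc n)      ∎
    where open ≡-Reasoning
  ξ^-+ a -[1+ zero ] = trans (ξ^-pred a) (trans (*ᴱ-comm ξ⁻¹ _) (cong (ξ^ a *ᴱ_) (sym (*ᴱ-identityʳ ξ⁻¹))))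
  ξ^-+ a -[1+ suc n ] = begin
    ξ^ (a + -[1+ suc n ])          ≡⟨ cong ξ^ (trans (cong (λ k → a + -[1+ suc k ]) (sym (ℕ.+-identityʳ n)))
                                                 (sym (ℤ.+-assoc a -[1+ n ] -1ℤ))) ⟩
    ξ^ ((a + -[1+ n ]) - 1ℤ)       ≡⟨ ξ^-pred (a + -[1+ n ]) ⟩
    ξ⁻¹ *ᴱ ξ^ (a + -[1+ n ])       ≡⟨ cong (ξ⁻¹ *ᴱ_) (ξ^-+ a -[1+ n ]) ⟩
    ξ⁻¹ *ᴱ (ξ^ a *ᴱ ξ^ -[1+ n ])   ≡⟨ commute ξ⁻¹ (ξ^ a) (ξ^ -[1+ n ]) ⟩
    ξ^ a *ᴱ ξ^ -[1+ suc n ]        ∎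
    where open ≡-Reasoning

_≟ᴱ_ : (x y : 𝔼) → Dec (x ≡ y)
(a +ω b) ≟ᴱ (c +ω d) with a ℤ.≟ c | b ℤ.≟ d
... | yes refl | yes refl = yes refl
... | no a≢c   | _        = no (λ eq → a≢c (cong re eq))
... | yes _    | no b≢d   = no (λ eq → b≢d (cong im eq))

0ᴱ≢1ᴱ : 0ᴱ ≢ 1ᴱ
0ᴱ≢1ᴱ ()

-- Norms and units of ℤ[ω]

N : 𝔼 → ℤ
N (a +ω b) = a * a - a * b + b * b

N-*ᴱ : ∀ x y → N (x *ᴱ y) ≡ N x * N y
N-*ᴱ (a +ω b) (c +ω d) = expand a b c d
  where
  expand : ∀ a b c d →
    (a * c - b * d) * (a * c - b * d) - (a * c - b * d) * ((a * d + b * c) - b * d)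
      + ((a * d + b * c) - b * d) * ((a * d + b * c) - b * d)
    ≡ (a * a - a * b + b * b) * (c * c - c * d + d * d)
  expand = solve-∀

four-N : ∀ a b → + 4 * (a * a - a * b + b * b) ≡ (+ 2 * a - b) * (+ 2 * a - b) + + 3 * (b * b)
four-N = solve-∀

square-abs : ∀ i → i * i ≡ + (∣ i ∣ ℕ.* ∣ i ∣)
square-abs (+ n)    = sym (ℤ.pos-* n n)
square-abs -[1+ n ] = refl

four-N-as-ℕ : ∀ a b →
  + 4 * N (a +ω b) ≡ + (∣ + 2 * a - b ∣ ℕ.* ∣ + 2 * a - b ∣ ℕ.+ 3 ℕ.* (∣ b ∣ ℕ.* ∣ b ∣))
four-N-as-ℕ a b = trans (four-N a b) (cong₂ _+_ (square-abs (+ 2 * a - b))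
  (trans (cong (+ 3 *_) (square-abs b)) (sym (ℤ.pos-* 3 (∣ b ∣ ℕ.* ∣ b ∣)))))

N-as-sum-of-squares : ∀ a b → Σ ℕ λ k → N (a +ω b) ≡ + k ×
  4 ℕ.* k ≡ ∣ + 2 * a - b ∣ ℕ.* ∣ + 2 * a - b ∣ ℕ.+ 3 ℕ.* (∣ b ∣ ℕ.* ∣ b ∣)
N-as-sum-of-squares a b with N (a +ω b) | four-N-as-ℕ a b
... | + k      | eq = k , refl , ℤ.+-injective (trans (ℤ.pos-* 4 k) eq)
... | -[1+ k ] | ()

sum-of-squares≡4⇒≤1 : ∀ U B → 4 ≡ U ℕ.* U ℕ.+ 3 ℕ.* (B ℕ.* B) → B ℕ.≤ 1
sum-of-squares≡4⇒≤1 U zero          _  = z≤n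
sum-of-squares≡4⇒≤1 U (suc zero)    _  = s≤s z≤n
sum-of-squares≡4⇒≤1 U (suc (suc k)) eq = ⊥-elim (ℕ.<⇒≱ 4<12 (ℕ.≤-trans 12≤ (ℕ.≤-reflexive (sym eq))))
  where
  B = suc (suc k)
  4<12 : 4 ℕ.< 12
  4<12 = ℕ.m≤m+n 5 7
  12≤ : 12 ℕ.≤ U ℕ.* U ℕ.+ 3 ℕ.* (B ℕ.* B)
  12≤ = ℕ.≤-trans (ℕ.*-monoʳ-≤ 3 (ℕ.*-mono-≤ {2} {B} {2} {B} (s≤s (s≤s z≤n)) (s≤s (s≤s z≤n))))
                  (ℕ.m≤n+m (3 ℕ.* (B ℕ.* B)) (U ℕ.* U))

N≡1⇒bounded : ∀ a b → N (a +ω b) ≡ 1ℤ → ∣ a ∣ ℕ.≤ 1 × ∣ b ∣ ℕ.≤ 1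
N≡1⇒bounded a b N≡1 = bound b a (trans (N-symmetric b a) N≡1) , bound a b N≡1
  where
  N-symmetric : ∀ a b → a * a - a * b + b * b ≡ b * b - b * a + a * a
  N-symmetric = solve-∀
  bound : ∀ a b → N (a +ω b) ≡ 1ℤ → ∣ b ∣ ℕ.≤ 1
  bound a b N≡1 with N-as-sum-of-squares a b
  ... | k , N≡k , 4k≡ = sum-of-squares≡4⇒≤1 ∣ + 2 * a - b ∣ ∣ b ∣ (trans (cong (4 ℕ.*_) (sym k≡1)) 4k≡)
    where
    k≡1 : k ≡ 1
    k≡1 = ℤ.+-injective (trans (sym N≡k) N≡1)

IsSign : ℤ → Set
IsSign s = s ≡ 1ℤ ⊎ s ≡ -1ℤ

IsSignedPowerOfω : 𝔼 → Set
IsSignedPowerOfω x = Σ ℤ λ s → Σ (Fin 3) λ k → IsSign s × x ≡ s · ω ^ toℕ k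

N≡1⇒signedPowerOfω : ∀ a b → N (a +ω b) ≡ 1ℤ → IsSignedPowerOfω (a +ω b)
N≡1⇒signedPowerOfω a b N≡1 = classify a b (N≡1⇒bounded a b N≡1) N≡1
  where
  classify : ∀ a b → ∣ a ∣ ℕ.≤ 1 × ∣ b ∣ ℕ.≤ 1 → N (a +ω b) ≡ 1ℤ → IsSignedPowerOfω (a +ω b)
  classify (+ 1)     (+ 0)     _ _ = 1ℤ  , zero , inj₁ refl , refl
  classify (+ 0)     (+ 1)     _ _ = 1ℤ  , suc zero , inj₁ refl , refl
  classify -[1+ 0 ]  -[1+ 0 ]  _ _ = 1ℤ  , suc (suc zero) , inj₁ refl , refl
  classify -[1+ 0 ]  (+ 0)     _ _ = -1ℤ , zero , inj₂ refl , refl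
  classify (+ 0)     -[1+ 0 ]  _ _ = -1ℤ , suc zero , inj₂ refl , refl
  classify (+ 1)     (+ 1)     _ _ = -1ℤ , suc (suc zero) , inj₂ refl , refl
  classify (+ 0)     (+ 0)     _ ()
  classify (+ 1)     -[1+ 0 ]  _ ()
  classify -[1+ 0 ]  (+ 1)     _ ()
  classify (+ suc (suc _)) _   (s≤s () , _) _
  classify -[1+ suc _ ] _      (s≤s () , _) _
  classify _ (+ suc (suc _))   (_ , s≤s ()) _
  classify _ -[1+ suc _ ]      (_ , s≤s ()) _

unit⇒signedPowerOfω : ∀ x y → x *ᴱ y ≡ 1ᴱ → IsSignedPowerOfω x
unit⇒signedPowerOfω (a +ω b) y xy≡1 with N-as-sum-of-squares a b | N-as-sum-of-squares (re y) (im y)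
... | k , Nx≡k , _ | l , Ny≡l , _ = N≡1⇒signedPowerOfω a b (trans Nx≡k (cong +_ k≡1))
  where
  k≡1 : k ≡ 1
  k≡1 = ℕ.m*n≡1⇒m≡1 k l (ℤ.+-injective (begin
    + (k ℕ.* l)          ≡⟨ ℤ.pos-* k l ⟩
    + k * + l            ≡⟨ cong₂ _*_ Nx≡k Ny≡l ⟨
    N (a +ω b) * N y     ≡⟨ N-*ᴱ (a +ω b) y ⟨
    N ((a +ω b) *ᴱ y)    ≡⟨ cong N xy≡1 ⟩
    + 1                  ∎))
    where open ≡-Reasoning

N≡0⇒≡0ᴱ : ∀ x → N x ≡ 0ℤ → x ≡ 0ᴱ
N≡0⇒≡0ᴱ (a +ω b) N≡0 with N-as-sum-of-squares a b
... | k , N≡k , 4k≡ with both-zero ∣ + 2 * a - b ∣ ∣ b ∣ (trans (sym 4k≡) (cong (4 ℕ.*_) k≡0))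
  where
  k≡0 : k ≡ 0
  k≡0 = ℤ.+-injective (trans (sym N≡k) N≡0)
  both-zero : ∀ U B → U ℕ.* U ℕ.+ 3 ℕ.* (B ℕ.* B) ≡ 0 → U ≡ 0 × B ≡ 0
  both-zero zero    zero    _ = refl , refl
  both-zero zero    (suc _) ()
  both-zero (suc _) _       ()
... | ∣2a-b∣≡0 , ∣b∣≡0 = +ω-cong a≡0 b≡0
  where
  b≡0 : b ≡ 0ℤ
  b≡0 = ℤ.∣i∣≡0⇒i≡0 ∣b∣≡0
  2a≡0 : + 2 * a ≡ + 2 * 0ℤ
  2a≡0 = trans (split a b) (cong₂ _+_ (ℤ.∣i∣≡0⇒i≡0 {+ 2 * a - b} ∣2a-b∣≡0) b≡0)
    where
    split : ∀ a b → + 2 * a ≡ (+ 2 * a - b) + b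
    split = solve-∀
  a≡0 : a ≡ 0ℤ
  a≡0 = ℤ.*-cancelˡ-≡ (+ 2) a 0ℤ 2a≡0

x*ᴱy≡0⇒x≡0∨y≡0 : ∀ x y → x *ᴱ y ≡ 0ᴱ → x ≡ 0ᴱ ⊎ y ≡ 0ᴱ
x*ᴱy≡0⇒x≡0∨y≡0 x y xy≡0 =
  Data.Sum.map (N≡0⇒≡0ᴱ x) (N≡0⇒≡0ᴱ y) (ℤ.i*j≡0⇒i≡0∨j≡0 (N x) {N y} NxNy≡0)
  where
  NxNy≡0 : N x * N y ≡ 0ℤ
  NxNy≡0 = trans (sym (N-*ᴱ x y)) (cong N xy≡0)

-- Coefficients and evaluations of Laurent polynomials

infix 4 _≗ᶜ_
_≗ᶜ_ : LPoly → LPoly → Set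
f ≗ᶜ g = ∀ i j → coeff f i j ≡ coeff g i j

hits : Term → ℤ → ℤ → Bool
hits (_ , a , b) i j = ⌊ a ≟ i ⌋ ∧ ⌊ b ≟ j ⌋

termCoeff : Term → ℤ → ℤ → ℤ
termCoeff t@(c , _ , _) i j = if hits t i j then c else 0ℤ

termCoeff-miss : ∀ c a b i j → ¬ (a ≡ i × b ≡ j) → termCoeff (c , a , b) i j ≡ 0ℤ
termCoeff-miss c a b i j a,b≢i,j with a ≟ i | b ≟ j
... | yes a≡i | yes b≡j = ⊥-elim (a,b≢i,j (a≡i , b≡j))
... | yes _   | no _    = refl
... | no _    | _       = refl

coeff-++ : ∀ p q i j → coeff (p ++ q) i j ≡ coeff p i j + coeff q i j
coeff-++ [] q i j = sym (ℤ.+-identityˡ _)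
coeff-++ (t ∷ p) q i j = trans (cong (λ k → termCoeff t i j + k) (coeff-++ p q i j))
                               (sym (ℤ.+-assoc (termCoeff t i j) (coeff p i j) (coeff q i j)))

coeff-⊖ : ∀ p i j → coeff (⊖ p) i j ≡ - coeff p i j
coeff-⊖ [] i j = refl
coeff-⊖ (t@(c , a , b) ∷ p) i j =
  trans (cong₂ _+_ (neg-if (hits t i j)) (coeff-⊖ p i j))
        (sym (ℤ.neg-distrib-+ (termCoeff t i j) (coeff p i j)))
  where
  neg-if : ∀ h → (if h then - c else 0ℤ) ≡ - (if h then c else 0ℤ)
  neg-if true  = refl
  neg-if false = refl

coeff-⊕⊖ : ∀ p q i j → coeff (p ⊕ (⊖ q)) i j ≡ coeff p i j - coeff q i j
coeff-⊕⊖ p q i j = trans (coeff-++ p (⊖ q) i j) (cong (λ k → coeff p i j + k) (coeff-⊖ q i j))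

⌊+≟⌋≡⌊≟-⌋ : ∀ x i y → ⌊ x + i ≟ y ⌋ ≡ ⌊ x ≟ y - i ⌋
⌊+≟⌋≡⌊≟-⌋ x i y with x + i ≟ y | x ≟ y - i
... | yes _     | yes _     = refl
... | no _      | no _      = refl
... | yes x+i≡y | no x≢y-i  = ⊥-elim (x≢y-i (trans (cancel x i) (cong (_- i) x+i≡y)))
  where
  cancel : ∀ x i → x ≡ (x + i) - i
  cancel = solve-∀
... | no x+i≢y  | yes x≡y-i = ⊥-elim (x+i≢y (trans (cong (_+ i) x≡y-i) (cancel y i)))
  where
  cancel : ∀ y i → (y - i) + i ≡ y
  cancel = solve-∀

dropAt : ℤ → ℤ → LPoly → LPoly
dropAt a b [] = []
dropAt a b (t ∷ p) = if hits t a b then dropAt a b p else t ∷ dropAt a b p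

length-dropAt : ∀ a b p → length (dropAt a b p) ℕ.≤ length p
length-dropAt a b [] = z≤n
length-dropAt a b (t ∷ p) with hits t a b
... | true  = ℕ.m≤n⇒m≤1+n (length-dropAt a b p)
... | false = s≤s (length-dropAt a b p)

length-dropAt-head : ∀ c a b p → length (dropAt a b ((c , a , b) ∷ p)) ℕ.≤ length p
length-dropAt-head c a b p with a ≟ a | b ≟ b
... | yes _ | yes _ = length-dropAt a b p
... | yes _ | no b≢b = ⊥-elim (b≢b refl)
... | no a≢a | _ = ⊥-elim (a≢a refl)

coeff-dropAt-self : ∀ a b p → coeff (dropAt a b p) a b ≡ 0ℤ
coeff-dropAt-self a b [] = refl
coeff-dropAt-self a b ((c , a' , b') ∷ p) with a' ≟ a | b' ≟ b
... | yes _ | yes _ = coeff-dropAt-self a b p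
... | yes _ | no b'≢b =
  trans (cong (_+ _) (termCoeff-miss c a' b' a b (λ (_ , b'≡b) → b'≢b b'≡b)))
        (trans (ℤ.+-identityˡ _) (coeff-dropAt-self a b p))
... | no a'≢a | _ =
  trans (cong (_+ _) (termCoeff-miss c a' b' a b (λ (a'≡a , _) → a'≢a a'≡a)))
        (trans (ℤ.+-identityˡ _) (coeff-dropAt-self a b p))

coeff-dropAt-other : ∀ a b p i j → ¬ (a ≡ i × b ≡ j) → coeff (dropAt a b p) i j ≡ coeff p i j
coeff-dropAt-other a b [] i j _ = refl
coeff-dropAt-other a b ((c , a' , b') ∷ p) i j a,b≢i,j with a' ≟ a | b' ≟ b
... | yes refl | yes refl =
  trans (coeff-dropAt-other a b p i j a,b≢i,j)
        (sym (trans (cong (_+ coeff p i j) (termCoeff-miss c a b i j a,b≢i,j)) (ℤ.+-identityˡ _)))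
... | yes _ | no _ = cong (λ k → termCoeff (c , a' , b') i j + k) (coeff-dropAt-other a b p i j a,b≢i,j)
... | no _  | _    = cong (λ k → termCoeff (c , a' , b') i j + k) (coeff-dropAt-other a b p i j a,b≢i,j)

coeff-dropAt-zero : ∀ a b p → (∀ i j → coeff p i j ≡ 0ℤ) → ∀ i j → coeff (dropAt a b p) i j ≡ 0ℤ
coeff-dropAt-zero a b p p≡0 i j with a ≟ i | b ≟ j
... | yes refl | yes refl = coeff-dropAt-self a b p
... | yes _ | no b≢j = trans (coeff-dropAt-other a b p i j (λ (_ , b≡j) → b≢j b≡j)) (p≡0 i j)
... | no a≢i | _ = trans (coeff-dropAt-other a b p i j (λ (a≡i , _) → a≢i a≡i)) (p≡0 i j)

eval : (ℤ → ℤ → 𝔼) → LPoly → 𝔼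
eval e [] = 0ᴱ
eval e ((c , a , b) ∷ p) = c · e a b +ᴱ eval e p

module _ (e : ℤ → ℤ → 𝔼) where

  eval-++ : ∀ p q → eval e (p ++ q) ≡ eval e p +ᴱ eval e q
  eval-++ [] q = sym (+ᴱ-identityˡ _)
  eval-++ ((c , a , b) ∷ p) q =
    trans (cong (c · e a b +ᴱ_) (eval-++ p q)) (sym (+ᴱ-assoc (c · e a b) (eval e p) (eval e q)))

  eval-⊖ : ∀ p → eval e (⊖ p) ≡ -ᴱ eval e p
  eval-⊖ [] = refl
  eval-⊖ ((c , a , b) ∷ p) =
    trans (cong₂ _+ᴱ_ (neg-· c (e a b)) (eval-⊖ p)) (sym (-ᴱ-distrib-+ᴱ (c · e a b) (eval e p)))

  eval-⊕⊖ : ∀ p q → eval e (p ⊕ (⊖ q)) ≡ eval e p +ᴱ -ᴱ eval e q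
  eval-⊕⊖ p q = trans (eval-++ p (⊖ q)) (cong (eval e p +ᴱ_) (eval-⊖ q))

  eval-dropAt-skip : ∀ {a b p} x → eval e p ≡ coeff p a b · e a b +ᴱ eval e (dropAt a b p) →
    x +ᴱ eval e p ≡ (0ℤ + coeff p a b) · e a b +ᴱ (x +ᴱ eval e (dropAt a b p))
  eval-dropAt-skip {a} {b} {p} x eq = begin
    x +ᴱ eval e p
      ≡⟨ cong (x +ᴱ_) eq ⟩
    x +ᴱ (coeff p a b · e a b +ᴱ eval e (dropAt a b p))
      ≡⟨ +ᴱ-leftComm x (coeff p a b · e a b) (eval e (dropAt a b p)) ⟩
    coeff p a b · e a b +ᴱ (x +ᴱ eval e (dropAt a b p))
      ≡⟨ cong (λ k → k · e a b +ᴱ (x +ᴱ eval e (dropAt a b p))) (sym (ℤ.+-identityˡ (coeff p a b))) ⟩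
    (0ℤ + coeff p a b) · e a b +ᴱ (x +ᴱ eval e (dropAt a b p)) ∎
    where open ≡-Reasoning

  eval-dropAt : ∀ a b p → eval e p ≡ coeff p a b · e a b +ᴱ eval e (dropAt a b p)
  eval-dropAt a b [] = sym (+ᴱ-identityˡ 0ᴱ)
  eval-dropAt a b ((c , a' , b') ∷ p) with a' ≟ a | b' ≟ b
  ... | yes refl | yes refl = begin
    c · e a b +ᴱ eval e p
      ≡⟨ cong (c · e a b +ᴱ_) (eval-dropAt a b p) ⟩
    c · e a b +ᴱ (coeff p a b · e a b +ᴱ eval e (dropAt a b p))
      ≡⟨ sym (+ᴱ-assoc (c · e a b) (coeff p a b · e a b) (eval e (dropAt a b p))) ⟩
    (c · e a b +ᴱ coeff p a b · e a b) +ᴱ eval e (dropAt a b p)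
      ≡⟨ cong (_+ᴱ eval e (dropAt a b p)) (sym (·-distribʳ c (coeff p a b) (e a b))) ⟩
    (c + coeff p a b) · e a b +ᴱ eval e (dropAt a b p) ∎
    where open ≡-Reasoning
  ... | yes refl | no _ = eval-dropAt-skip (c · e a b') (eval-dropAt a b p)
  ... | no _ | _ = eval-dropAt-skip (c · e a' b') (eval-dropAt a b p)

  -- The terms sharing the head's exponent are dropped together; their total coefficient is 0.
  eval-zero : ∀ n p → length p ℕ.≤ n → (∀ i j → coeff p i j ≡ 0ℤ) → eval e p ≡ 0ᴱ
  eval-zero _ [] _ _ = refl
  eval-zero (suc n) p@((c , a , b) ∷ q) (s≤s |q|≤n) p≡0 = begin
    eval e p                                     ≡⟨ eval-dropAt a b p ⟩
    coeff p a b · e a b +ᴱ eval e (dropAt a b p) ≡⟨ cong₂ _+ᴱ_ (cong (_· e a b) (p≡0 a b)) rest≡0 ⟩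
    0ᴱ                                           ∎
    where
    open ≡-Reasoning
    rest≡0 : eval e (dropAt a b p) ≡ 0ᴱ
    rest≡0 = eval-zero n (dropAt a b p) (ℕ.≤-trans (length-dropAt-head c a b q) |q|≤n)
                       (coeff-dropAt-zero a b p p≡0)

  eval-cong : ∀ p q → p ≗ᶜ q → eval e p ≡ eval e q
  eval-cong p q p≗q = x-y≡0⇒x≡y (eval e p) (eval e q) (trans (sym (eval-⊕⊖ p q))
    (eval-zero (length (p ⊕ (⊖ q))) (p ⊕ (⊖ q)) ℕ.≤-refl λ i j →
      trans (coeff-⊕⊖ p q i j) (trans (cong (_- coeff q i j) (p≗q i j)) (ℤ.+-inverseʳ (coeff q i j)))))

coeff-∷-comm : ∀ s t p → (s ∷ t ∷ p) ≗ᶜ (t ∷ s ∷ p)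
coeff-∷-comm s t p i j = leftComm (termCoeff s i j) (termCoeff t i j) (coeff p i j)
  where
  leftComm : ∀ x y z → x + (y + z) ≡ y + (x + z)
  leftComm = solve-∀

coeff-∷-zero : ∀ a b p i j → coeff ((0ℤ , a , b) ∷ p) i j ≡ coeff p i j
coeff-∷-zero a b p i j = trans (cong (_+ coeff p i j) (zero-if (hits (0ℤ , a , b) i j))) (ℤ.+-identityˡ _)
  where
  zero-if : ∀ h → (if h then 0ℤ else 0ℤ) ≡ 0ℤ
  zero-if true  = refl
  zero-if false = refl

module _ {V : Set} (_⊹_ : V → V → V) (𝟘 : V) where

  sumBy : (Term → V) → LPoly → V
  sumBy g []      = 𝟘
  sumBy g (t ∷ p) = g t ⊹ sumBy g p

  coeff-concatMap-additive : (B : V → LPoly) → (∀ x y → (B x ++ B y) ≗ᶜ B (x ⊹ y)) →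
    (∀ i j → coeff (B 𝟘) i j ≡ 0ℤ) → ∀ g p → concatMap (B ∘ g) p ≗ᶜ B (sumBy g p)
  coeff-concatMap-additive B additive B𝟘≡0 g [] i j = sym (B𝟘≡0 i j)
  coeff-concatMap-additive B additive B𝟘≡0 g (t ∷ p) i j = begin
    coeff (B (g t) ++ concatMap (B ∘ g) p) i j              ≡⟨ coeff-++ (B (g t)) (concatMap (B ∘ g) p) i j ⟩
    coeff (B (g t)) i j + coeff (concatMap (B ∘ g) p) i j  ≡⟨ cong (λ k → coeff (B (g t)) i j + k)
                                                                   (coeff-concatMap-additive B additive B𝟘≡0 g p i j) ⟩
    coeff (B (g t)) i j + coeff (B (sumBy g p)) i j        ≡⟨ coeff-++ (B (g t)) (B (sumBy g p)) i j ⟨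
    coeff (B (g t) ++ B (sumBy g p)) i j                   ≡⟨ additive (g t) (sumBy g p) i j ⟩
    coeff (B (sumBy g (t ∷ p))) i j                        ∎
    where open ≡-Reasoning

⊗-distribʳ-++ : ∀ p p' q → (p ++ p') ⊗ q ≡ (p ⊗ q) ++ (p' ⊗ q)
⊗-distribʳ-++ p p' q = List.concatMap-++ (λ t → map (termMul t) q) p p'

-- The quotient S_{m,n}

module Quotient (m n : ℕ∞) where

  combination : LPoly → LPoly → LPoly
  combination A B = (A ⊗ ψX m) ⊕ (B ⊗ ψY n)

  coeff-combination-++ : ∀ A₁ A₂ B₁ B₂ i j →
    coeff (combination (A₁ ++ A₂) (B₁ ++ B₂)) i j ≡ coeff (combination A₁ B₁) i j + coeff (combination A₂ B₂) i j
  coeff-combination-++ A₁ A₂ B₁ B₂ i j = begin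
    coeff (combination (A₁ ++ A₂) (B₁ ++ B₂)) i j
      ≡⟨ coeff-++ ((A₁ ++ A₂) ⊗ ψX m) ((B₁ ++ B₂) ⊗ ψY n) i j ⟩
    coeff ((A₁ ++ A₂) ⊗ ψX m) i j + coeff ((B₁ ++ B₂) ⊗ ψY n) i j
      ≡⟨ cong₂ _+_ (split A₁ A₂ (ψX m)) (split B₁ B₂ (ψY n)) ⟩
    (x₁ + x₂) + (y₁ + y₂)
      ≡⟨ interchange x₁ x₂ y₁ y₂ ⟩
    (x₁ + y₁) + (x₂ + y₂)
      ≡⟨ sym (cong₂ _+_ (coeff-++ (A₁ ⊗ ψX m) (B₁ ⊗ ψY n) i j) (coeff-++ (A₂ ⊗ ψX m) (B₂ ⊗ ψY n) i j)) ⟩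
    coeff (combination A₁ B₁) i j + coeff (combination A₂ B₂) i j ∎
    where
    open ≡-Reasoning
    x₁ = coeff (A₁ ⊗ ψX m) i j
    x₂ = coeff (A₂ ⊗ ψX m) i j
    y₁ = coeff (B₁ ⊗ ψY n) i j
    y₂ = coeff (B₂ ⊗ ψY n) i j
    split : ∀ p p' q → coeff ((p ++ p') ⊗ q) i j ≡ coeff (p ⊗ q) i j + coeff (p' ⊗ q) i j
    split p p' q = trans (cong (λ r → coeff r i j) (⊗-distribʳ-++ p p' q)) (coeff-++ (p ⊗ q) (p' ⊗ q) i j)
    interchange : ∀ a b c d → (a + b) + (c + d) ≡ (a + c) + (b + d)
    interchange = solve-∀

  InIdeal-cong : ∀ f g → f ≗ᶜ g → InIdeal m n f → InIdeal m n g
  InIdeal-cong f g f≗g (A , B , f≗AB) = A , B , λ i j → trans (sym (f≗g i j)) (f≗AB i j)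

  InIdeal-++ : ∀ f g → InIdeal m n f → InIdeal m n g → InIdeal m n (f ++ g)
  InIdeal-++ f g (A₁ , B₁ , f≗) (A₂ , B₂ , g≗) = A₁ ++ A₂ , B₁ ++ B₂ , λ i j → begin
    coeff (f ++ g) i j                                              ≡⟨ coeff-++ f g i j ⟩
    coeff f i j + coeff g i j                                       ≡⟨ cong₂ _+_ (f≗ i j) (g≗ i j) ⟩
    coeff (combination A₁ B₁) i j + coeff (combination A₂ B₂) i j ≡⟨ sym (coeff-combination-++ A₁ A₂ B₁ B₂ i j) ⟩
    coeff (combination (A₁ ++ A₂) (B₁ ++ B₂)) i j                   ∎
    where open ≡-Reasoning

  -- A wrapper around _≈[ m , n ]_ that lets Agda infer both sides.
  infix 4 _∼_
  record _∼_ (f g : LPoly) : Set where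
    constructor by-ideal
    field
      difference∈I : f ≈[ m , n ] g
  open _∼_ public

  ≗ᶜ⇒∼ : ∀ {f g} → f ≗ᶜ g → f ∼ g
  ≗ᶜ⇒∼ {f} {g} f≗g = by-ideal ([] , [] , λ i j →
    trans (coeff-⊕⊖ f g i j) (trans (cong (_- coeff g i j) (f≗g i j)) (ℤ.+-inverseʳ (coeff g i j))))

  ∼-trans : ∀ {f g h} → f ∼ g → g ∼ h → f ∼ h
  ∼-trans {f} {g} {h} (by-ideal f∼g) (by-ideal g∼h) =
    by-ideal (InIdeal-cong ((f ⊕ (⊖ g)) ++ (g ⊕ (⊖ h))) (f ⊕ (⊖ h)) sum≗
                           (InIdeal-++ (f ⊕ (⊖ g)) (g ⊕ (⊖ h)) f∼g g∼h))
    where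
    telescope : ∀ (x y z : ℤ) → (x - y) + (y - z) ≡ x - z
    telescope = solve-∀
    sum≗ : ((f ⊕ (⊖ g)) ++ (g ⊕ (⊖ h))) ≗ᶜ (f ⊕ (⊖ h))
    sum≗ i j = begin
      coeff ((f ⊕ (⊖ g)) ++ (g ⊕ (⊖ h))) i j
        ≡⟨ coeff-++ (f ⊕ (⊖ g)) (g ⊕ (⊖ h)) i j ⟩
      coeff (f ⊕ (⊖ g)) i j + coeff (g ⊕ (⊖ h)) i j
        ≡⟨ cong₂ _+_ (coeff-⊕⊖ f g i j) (coeff-⊕⊖ g h i j) ⟩
      (coeff f i j - coeff g i j) + (coeff g i j - coeff h i j)
        ≡⟨ telescope (coeff f i j) (coeff g i j) (coeff h i j) ⟩
      coeff f i j - coeff h i j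
        ≡⟨ sym (coeff-⊕⊖ f h i j) ⟩
      coeff (f ⊕ (⊖ h)) i j ∎
      where open ≡-Reasoning

  ∼-++ : ∀ {f₁ g₁ f₂ g₂} → f₁ ∼ g₁ → f₂ ∼ g₂ → (f₁ ++ f₂) ∼ (g₁ ++ g₂)
  ∼-++ {f₁} {g₁} {f₂} {g₂} (by-ideal f₁∼g₁) (by-ideal f₂∼g₂) =
    by-ideal (InIdeal-cong ((f₁ ⊕ (⊖ g₁)) ++ (f₂ ⊕ (⊖ g₂))) ((f₁ ++ f₂) ⊕ (⊖ (g₁ ++ g₂))) sum≗
                           (InIdeal-++ (f₁ ⊕ (⊖ g₁)) (f₂ ⊕ (⊖ g₂)) f₁∼g₁ f₂∼g₂))
    where
    regroup : ∀ (x y z w : ℤ) → (x - y) + (z - w) ≡ (x + z) - (y + w)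
    regroup = solve-∀
    sum≗ : ((f₁ ⊕ (⊖ g₁)) ++ (f₂ ⊕ (⊖ g₂))) ≗ᶜ ((f₁ ++ f₂) ⊕ (⊖ (g₁ ++ g₂)))
    sum≗ i j = begin
      coeff ((f₁ ⊕ (⊖ g₁)) ++ (f₂ ⊕ (⊖ g₂))) i j
        ≡⟨ coeff-++ (f₁ ⊕ (⊖ g₁)) (f₂ ⊕ (⊖ g₂)) i j ⟩
      coeff (f₁ ⊕ (⊖ g₁)) i j + coeff (f₂ ⊕ (⊖ g₂)) i j
        ≡⟨ cong₂ _+_ (coeff-⊕⊖ f₁ g₁ i j) (coeff-⊕⊖ f₂ g₂ i j) ⟩
      (coeff f₁ i j - coeff g₁ i j) + (coeff f₂ i j - coeff g₂ i j)
        ≡⟨ regroup (coeff f₁ i j) (coeff g₁ i j) (coeff f₂ i j) (coeff g₂ i j) ⟩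
      (coeff f₁ i j + coeff f₂ i j) - (coeff g₁ i j + coeff g₂ i j)
        ≡⟨ sym (cong₂ _-_ (coeff-++ f₁ f₂ i j) (coeff-++ g₁ g₂ i j)) ⟩
      coeff (f₁ ++ f₂) i j - coeff (g₁ ++ g₂) i j
        ≡⟨ sym (coeff-⊕⊖ (f₁ ++ f₂) (g₁ ++ g₂) i j) ⟩
      coeff ((f₁ ++ f₂) ⊕ (⊖ (g₁ ++ g₂))) i j ∎
      where open ≡-Reasoning

  ∼-concatMap : (r : Term → LPoly) → (∀ t → (t ∷ []) ∼ r t) → ∀ f → f ∼ concatMap r f
  ∼-concatMap r t∼rt [] = ≗ᶜ⇒∼ (λ i j → refl)
  ∼-concatMap r t∼rt (t ∷ f) = ∼-++ (t∼rt t) (∼-concatMap r t∼rt f)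

  ∼-vanishing⇒InIdeal : ∀ {f g} → f ∼ g → (∀ i j → coeff g i j ≡ 0ℤ) → InIdeal m n f
  ∼-vanishing⇒InIdeal {f} {g} (by-ideal f∼g) g≡0 = InIdeal-cong (f ⊕ (⊖ g)) f f⊖g≗f f∼g
    where
    f⊖g≗f : (f ⊕ (⊖ g)) ≗ᶜ f
    f⊖g≗f i j = trans (coeff-⊕⊖ f g i j)
      (trans (cong (λ k → coeff f i j - k) (g≡0 i j)) (ℤ.+-identityʳ (coeff f i j)))

  head∼⊖tail : ∀ t p → InIdeal m n (t ∷ p) → (t ∷ []) ∼ ⊖ p
  head∼⊖tail t p t∷p∈I = by-ideal (InIdeal-cong (t ∷ p) ((t ∷ []) ⊕ (⊖ (⊖ p))) double-negation t∷p∈I)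
    where
    double-negation : (t ∷ p) ≗ᶜ ((t ∷ []) ⊕ (⊖ (⊖ p)))
    double-negation i j = cong (λ k → termCoeff t i j + k) (sym (begin
      coeff (⊖ (⊖ p)) i j ≡⟨ coeff-⊖ (⊖ p) i j ⟩
      - coeff (⊖ p) i j   ≡⟨ cong -_ (coeff-⊖ p i j) ⟩
      - - coeff p i j     ≡⟨ ℤ.neg-involutive (coeff p i j) ⟩
      coeff p i j         ∎))
      where open ≡-Reasoning

  head∼⊖tail-swapped : ∀ s t p → InIdeal m n (s ∷ t ∷ p) → (t ∷ []) ∼ ⊖ (s ∷ p)
  head∼⊖tail-swapped s t p s∷t∷p∈I =
    head∼⊖tail t (s ∷ p) (InIdeal-cong (s ∷ t ∷ p) (t ∷ s ∷ p) (coeff-∷-comm s t p) s∷t∷p∈I)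

  module _ (e : ℤ → ℤ → 𝔼) (kills-ψX : ∀ A → eval e (A ⊗ ψX m) ≡ 0ᴱ)
                           (kills-ψY : ∀ B → eval e (B ⊗ ψY n) ≡ 0ᴱ) where

    eval-InIdeal : ∀ {f} → InIdeal m n f → eval e f ≡ 0ᴱ
    eval-InIdeal {f} (A , B , f≗AB) = begin
      eval e f                                       ≡⟨ eval-cong e f (combination A B) f≗AB ⟩
      eval e (combination A B)                       ≡⟨ eval-++ e (A ⊗ ψX m) (B ⊗ ψY n) ⟩
      eval e (A ⊗ ψX m) +ᴱ eval e (B ⊗ ψY n)         ≡⟨ cong₂ _+ᴱ_ (kills-ψX A) (kills-ψY B) ⟩
      0ᴱ                                             ∎
      where open ≡-Reasoning

    eval-∼ : ∀ {f g} → f ∼ g → eval e f ≡ eval e g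
    eval-∼ {f} {g} (by-ideal f∼g) =
      x-y≡0⇒x≡y (eval e f) (eval e g) (trans (sym (eval-⊕⊖ e f g)) (eval-InIdeal {f ⊕ (⊖ g)} f∼g))

swapTerm : Term → Term
swapTerm (c , a , b) = c , b , a

swapVars : LPoly → LPoly
swapVars = map swapTerm

coeff-swapVars : ∀ p i j → coeff (swapVars p) i j ≡ coeff p j i
coeff-swapVars [] i j = refl
coeff-swapVars ((c , a , b) ∷ p) i j =
  cong₂ _+_ (cong (λ h → if h then c else 0ℤ) (Bool.∧-comm ⌊ b ≟ i ⌋ ⌊ a ≟ j ⌋)) (coeff-swapVars p i j)

swapVars-⊗ : ∀ p q → swapVars (p ⊗ q) ≡ swapVars p ⊗ swapVars q
swapVars-⊗ p q = begin
  swapVars (concatMap (λ t → map (termMul t) q) p)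
    ≡⟨ List.map-concatMap swapTerm (λ t → map (termMul t) q) p ⟩
  concatMap (λ t → swapVars (map (termMul t) q)) p
    ≡⟨ List.concatMap-cong (λ t → trans (sym (List.map-∘ q)) (List.map-∘ q)) p ⟩
  concatMap (λ t → map (termMul (swapTerm t)) (swapVars q)) p
    ≡⟨ List.concatMap-map (λ t → map (termMul t) (swapVars q)) swapTerm p ⟨
  swapVars p ⊗ swapVars q ∎
  where open ≡-Reasoning

swapVars-ψX : ∀ m → swapVars (ψX m) ≡ ψY m
swapVars-ψX (fin m) = sym (List.map-∘ (upTo m))
swapVars-ψX ∞ = refl

swapVars-ψY : ∀ n → swapVars (ψY n) ≡ ψX n
swapVars-ψY (fin n) = sym (List.map-∘ (upTo n))
swapVars-ψY ∞ = refl

InIdeal-swapVars : ∀ m n f → InIdeal m n f → InIdeal n m (swapVars f)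
InIdeal-swapVars m n f (A , B , f≗AB) = swapVars B , swapVars A , λ i j → begin
  coeff (swapVars f) i j
    ≡⟨ coeff-swapVars f i j ⟩
  coeff f j i
    ≡⟨ f≗AB j i ⟩
  coeff ((A ⊗ ψX m) ++ (B ⊗ ψY n)) j i
    ≡⟨ coeff-++ (A ⊗ ψX m) (B ⊗ ψY n) j i ⟩
  coeff (A ⊗ ψX m) j i + coeff (B ⊗ ψY n) j i
    ≡⟨ ℤ.+-comm (coeff (A ⊗ ψX m) j i) (coeff (B ⊗ ψY n) j i) ⟩
  coeff (B ⊗ ψY n) j i + coeff (A ⊗ ψX m) j i
    ≡⟨ cong₂ _+_ (swapped B (swapVars-ψY n) i j) (swapped A (swapVars-ψX m) i j) ⟩
  coeff (swapVars B ⊗ ψX n) i j + coeff (swapVars A ⊗ ψY m) i j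
    ≡⟨ coeff-++ (swapVars B ⊗ ψX n) (swapVars A ⊗ ψY m) i j ⟨
  coeff ((swapVars B ⊗ ψX n) ++ (swapVars A ⊗ ψY m)) i j ∎
  where
  open ≡-Reasoning
  swapped : ∀ p {ψ ψ'} → swapVars ψ ≡ ψ' → ∀ i j → coeff (p ⊗ ψ) j i ≡ coeff (swapVars p ⊗ ψ') i j
  swapped p {ψ} refl i j = trans (sym (coeff-swapVars (p ⊗ ψ) i j)) (cong (λ r → coeff r i j) (swapVars-⊗ p ψ))

∼-swapVars : ∀ {m n f g} → Quotient._∼_ m n f g → Quotient._∼_ n m (swapVars f) (swapVars g)
∼-swapVars {m} {n} {f} {g} (Quotient.by-ideal f⊖g∈I) = Quotient.by-ideal
  (Quotient.InIdeal-cong n m (swapVars (f ⊕ (⊖ g))) (swapVars f ⊕ (⊖ swapVars g)) swapped-difference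
    (InIdeal-swapVars m n (f ⊕ (⊖ g)) f⊖g∈I))
  where
  swapped-difference : swapVars (f ⊕ (⊖ g)) ≗ᶜ (swapVars f ⊕ (⊖ swapVars g))
  swapped-difference i j = begin
    coeff (swapVars (f ⊕ (⊖ g))) i j              ≡⟨ coeff-swapVars (f ⊕ (⊖ g)) i j ⟩
    coeff (f ⊕ (⊖ g)) j i                         ≡⟨ coeff-⊕⊖ f g j i ⟩
    coeff f j i - coeff g j i                     ≡⟨ cong₂ _-_ (coeff-swapVars f i j) (coeff-swapVars g i j) ⟨
    coeff (swapVars f) i j - coeff (swapVars g) i j ≡⟨ coeff-⊕⊖ (swapVars f) (swapVars g) i j ⟨
    coeff (swapVars f ⊕ (⊖ swapVars g)) i j       ∎
    where open ≡-Reasoning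

-- Signed monomials are units

IsSignedMonomial : ℕ∞ → ℕ∞ → LPoly → Set
IsSignedMonomial m n u = Σ ℤ λ s → Σ ℤ λ i → Σ ℤ λ j → IsSign s × (u ≈[ m , n ] monomial s i j)

times : ℤ → ℤ → ℤ → Term → Term
times c i j t = termMul t (c , i , j)

⊗-monomial : ∀ f c i j → f ⊗ monomial c i j ≡ map (times c i j) f
⊗-monomial f c i j = trans (sym (List.concatMap-map [_] (times c i j) f)) (List.concatMap-pure (map (times c i j) f))

coeff-times : ∀ c i j f a b → coeff (map (times c i j) f) a b ≡ coeff f (a - i) (b - j) * c
coeff-times c i j [] a b = refl
coeff-times c i j ((d , a' , b') ∷ f) a b = begin
  (if ⌊ a' + i ≟ a ⌋ ∧ ⌊ b' + j ≟ b ⌋ then d * c else 0ℤ) + coeff (map (times c i j) f) a b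
    ≡⟨ cong₂ _+_ (cong₂ (λ h h' → if h ∧ h' then d * c else 0ℤ)
                        (⌊+≟⌋≡⌊≟-⌋ a' i a) (⌊+≟⌋≡⌊≟-⌋ b' j b))
                 (coeff-times c i j f a b) ⟩
  (if hit then d * c else 0ℤ) + coeff f (a - i) (b - j) * c
    ≡⟨ cong (_+ coeff f (a - i) (b - j) * c) (if-* hit) ⟩
  (if hit then d else 0ℤ) * c + coeff f (a - i) (b - j) * c
    ≡⟨ ℤ.*-distribʳ-+ c (if hit then d else 0ℤ) (coeff f (a - i) (b - j)) ⟨
  coeff ((d , a' , b') ∷ f) (a - i) (b - j) * c ∎
  where
  open ≡-Reasoning
  hit = ⌊ a' ≟ a - i ⌋ ∧ ⌊ b' ≟ b - j ⌋
  if-* : ∀ h → (if h then d * c else 0ℤ) ≡ (if h then d else 0ℤ) * c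
  if-* true  = refl
  if-* false = sym (ℤ.*-zeroˡ c)

times-⊗ : ∀ c i j p q → map (times c i j) (p ⊗ q) ≡ map (times c i j) p ⊗ q
times-⊗ c i j p q = begin
  map (times c i j) (concatMap (λ t → map (termMul t) q) p)
    ≡⟨ List.map-concatMap (times c i j) (λ t → map (termMul t) q) p ⟩
  concatMap (λ t → map (times c i j) (map (termMul t) q)) p
    ≡⟨ List.concatMap-cong (λ t → trans (sym (List.map-∘ q)) (List.map-cong (times-termMul t) q)) p ⟩
  concatMap (λ t → map (termMul (times c i j t)) q) p
    ≡⟨ List.concatMap-map (λ t → map (termMul t) q) (times c i j) p ⟨
  map (times c i j) p ⊗ q ∎
  where
  open ≡-Reasoning
  times-termMul : ∀ t s → times c i j (termMul t s) ≡ termMul (times c i j t) s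
  times-termMul (d , a , b) (d' , a' , b') =
    cong₂ _,_ (reorder d d' c) (cong₂ _,_ (reorder-+ a a' i) (reorder-+ b b' j))
    where
    reorder : ∀ x y z → (x * y) * z ≡ (x * z) * y
    reorder = solve-∀
    reorder-+ : ∀ x y z → (x + y) + z ≡ (x + z) + y
    reorder-+ = solve-∀

module _ (m n : ℕ∞) where
  open Quotient m n

  InIdeal-times : ∀ c i j f → InIdeal m n f → InIdeal m n (map (times c i j) f)
  InIdeal-times c i j f (A , B , f≗AB) = map (times c i j) A , map (times c i j) B , λ a b → begin
    coeff (map (times c i j) f) a b
      ≡⟨ coeff-times c i j f a b ⟩
    coeff f (a - i) (b - j) * c
      ≡⟨ cong (_* c) (f≗AB (a - i) (b - j)) ⟩
    coeff (combination A B) (a - i) (b - j) * c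
      ≡⟨ coeff-times c i j (combination A B) a b ⟨
    coeff (map (times c i j) (combination A B)) a b
      ≡⟨ cong (λ p → coeff p a b) (List.map-++ (times c i j) (A ⊗ ψX m) (B ⊗ ψY n)) ⟩
    coeff (map (times c i j) (A ⊗ ψX m) ++ map (times c i j) (B ⊗ ψY n)) a b
      ≡⟨ cong₂ (λ p q → coeff (p ++ q) a b) (times-⊗ c i j A (ψX m)) (times-⊗ c i j B (ψY n)) ⟩
    coeff (combination (map (times c i j) A) (map (times c i j) B)) a b ∎
    where open ≡-Reasoning

  ∼-times : ∀ c i j {f g} → f ∼ g → map (times c i j) f ∼ map (times c i j) g
  ∼-times c i j {f} {g} (by-ideal f⊖g∈I) = by-ideal
    (InIdeal-cong (map (times c i j) (f ⊕ (⊖ g))) (map (times c i j) f ⊕ (⊖ map (times c i j) g)) difference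
      (InIdeal-times c i j (f ⊕ (⊖ g)) f⊖g∈I))
    where
    difference : map (times c i j) (f ⊕ (⊖ g)) ≗ᶜ (map (times c i j) f ⊕ (⊖ map (times c i j) g))
    difference a b = begin
      coeff (map (times c i j) (f ⊕ (⊖ g))) a b
        ≡⟨ coeff-times c i j (f ⊕ (⊖ g)) a b ⟩
      coeff (f ⊕ (⊖ g)) (a - i) (b - j) * c
        ≡⟨ cong (_* c) (coeff-⊕⊖ f g (a - i) (b - j)) ⟩
      (coeff f (a - i) (b - j) - coeff g (a - i) (b - j)) * c
        ≡⟨ distrib-minus (coeff f (a - i) (b - j)) (coeff g (a - i) (b - j)) c ⟩
      coeff f (a - i) (b - j) * c - coeff g (a - i) (b - j) * c
        ≡⟨ cong₂ _-_ (coeff-times c i j f a b) (coeff-times c i j g a b) ⟨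
      coeff (map (times c i j) f) a b - coeff (map (times c i j) g) a b
        ≡⟨ coeff-⊕⊖ (map (times c i j) f) (map (times c i j) g) a b ⟨
      coeff (map (times c i j) f ⊕ (⊖ map (times c i j) g)) a b ∎
      where
      open ≡-Reasoning
      distrib-minus : ∀ x y z → (x - y) * z ≡ x * z - y * z
      distrib-minus = solve-∀

  signedMonomial⇒isUnit : ∀ u → IsSignedMonomial m n u → IsUnit m n u
  signedMonomial⇒isUnit u (s , i , j , s-sign , u≈) = monomial s (- i) (- j) , difference∈I u⊗v∼one
    where
    sign² : ∀ {s} → IsSign s → s * s ≡ 1ℤ
    sign² (inj₁ refl) = refl
    sign² (inj₂ refl) = refl
    product≡one : map (times s (- i) (- j)) (monomial s i j) ≡ one
    product≡one = cong₂ (λ c (a , b) → (c , a , b) ∷ []) (sign² s-sign) (cong₂ _,_ (ℤ.+-inverseʳ i) (ℤ.+-inverseʳ j))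
    u⊗v∼one : (u ⊗ monomial s (- i) (- j)) ∼ one
    u⊗v∼one = ∼-trans (≗ᶜ⇒∼ (λ a b → cong (λ p → coeff p a b) (⊗-monomial u s (- i) (- j))))
             (∼-trans (∼-times s (- i) (- j) {u} {monomial s i j} (by-ideal u≈))
                      (≗ᶜ⇒∼ (λ a b → cong (λ p → coeff p a b) product≡one)))

-- Reduction modulo ψ₂(x) and ψ₃(x)

ℤ-induction : ∀ {P : ℤ → Set} → P 0ℤ →
  (∀ a → P a → P (a + 1ℤ)) → (∀ a → P (a + 1ℤ) → P a) → ∀ a → P a
ℤ-induction {P} p₀ up down = induct
  where
  induct : ∀ a → P a
  induct (+ zero)        = p₀
  induct (+ suc k)       = subst P (ℤ.+-comm (+ k) 1ℤ) (up (+ k) (induct (+ k)))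
  induct -[1+ zero ]     = down -1ℤ p₀
  induct -[1+ suc k ]    = down -[1+ suc k ] (induct -[1+ k ])

ℤ-induction₂ : ∀ {P : ℤ → Set} → P 0ℤ → P 1ℤ →
  (∀ a → P a → P (a + 1ℤ) → P (a + 1ℤ + 1ℤ)) →
  (∀ a → P (a + 1ℤ) → P (a + 1ℤ + 1ℤ) → P a) → ∀ a → P a
ℤ-induction₂ {P} p₀ p₁ up down (+ k)    = proj₁ (upward k)
  where
  upward : ∀ k → P (+ k) × P (+ suc k)
  upward zero    = p₀ , p₁
  upward (suc k) with upward k
  ... | pk , pk+1 = pk+1 , subst P k+2 (up (+ k) pk (subst P (sym k+1) pk+1))
    where
    k+1 : + k + 1ℤ ≡ + suc k
    k+1 = ℤ.+-comm (+ k) 1ℤ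
    k+2 : + k + 1ℤ + 1ℤ ≡ + suc (suc k)
    k+2 = trans (cong (_+ 1ℤ) k+1) (ℤ.+-comm (+ suc k) 1ℤ)
ℤ-induction₂ {P} p₀ p₁ up down -[1+ k ] = proj₁ (downward k)
  where
  downward : ∀ k → P -[1+ k ] × P (-[1+ k ] + 1ℤ)
  downward zero    = down -1ℤ p₀ p₁ , p₀
  downward (suc k) with downward k
  ... | pk , pk+1 = down -[1+ suc k ] pk pk+1 , pk

reduced : 𝔼 → ℤ → LPoly
reduced (x +ω y) b = (x , 0ℤ , b) ∷ (y , 1ℤ , b) ∷ []

coeff-reduced-+ᴱ : ∀ z w b → (reduced z b ++ reduced w b) ≗ᶜ reduced (z +ᴱ w) b
coeff-reduced-+ᴱ (x +ω y) (x' +ω y') b i j =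
  trans (regroup (at₀ x) (at₁ y) (at₀ x') (at₁ y'))
        (cong₂ (λ u v → u + (v + 0ℤ)) (if-+ (hits (x , 0ℤ , b) i j) x x') (if-+ (hits (y , 1ℤ , b) i j) y y'))
  where
  at₀ at₁ : ℤ → ℤ
  at₀ k = termCoeff (k , 0ℤ , b) i j
  at₁ k = termCoeff (k , 1ℤ , b) i j
  regroup : ∀ u v u' v' → u + (v + (u' + (v' + 0ℤ))) ≡ (u + u') + ((v + v') + 0ℤ)
  regroup = solve-∀
  if-+ : ∀ h k l → (if h then k else 0ℤ) + (if h then l else 0ℤ) ≡ (if h then k + l else 0ℤ)
  if-+ true  k l = refl
  if-+ false k l = refl

coeff-reduced-0ᴱ : ∀ b i j → coeff (reduced 0ᴱ b) i j ≡ 0ℤ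
coeff-reduced-0ᴱ b i j = trans (coeff-∷-zero 0ℤ b ((0ℤ , 1ℤ , b) ∷ []) i j) (coeff-∷-zero 1ℤ b [] i j)

reducedY : 𝔼 → ℤ → LPoly
reducedY z a = swapVars (reduced z a)

coeff-reducedY-+ᴱ : ∀ z w a → (reducedY z a ++ reducedY w a) ≗ᶜ reducedY (z +ᴱ w) a
coeff-reducedY-+ᴱ z w a i j = trans (coeff-swapVars (reduced z a ++ reduced w a) i j)
  (trans (coeff-reduced-+ᴱ z w a j i) (sym (coeff-swapVars (reduced (z +ᴱ w) a) i j)))

coeff-reducedY-0ᴱ : ∀ a i j → coeff (reducedY 0ᴱ a) i j ≡ 0ℤ
coeff-reducedY-0ᴱ a i j = trans (coeff-swapVars (reduced 0ᴱ a) i j) (coeff-reduced-0ᴱ a j i)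

module XReduction₂ (n : ℕ∞) where
  open Quotient (fin 2) n
  open IntegerPowers -1ᴱ -1ᴱ refl

  ψ-relation : ∀ c a b → InIdeal (fin 2) n ((c , a , b) ∷ (c , a + 1ℤ , b) ∷ [])
  ψ-relation c a b = monomial c a b , [] , λ i j → cong (λ p → coeff p i j) expansion
    where
    expansion : (c , a , b) ∷ (c , a + 1ℤ , b) ∷ [] ≡ (monomial c a b ⊗ ψX (fin 2)) ⊕ ([] ⊗ ψY n)
    expansion = sym (cong₂ (λ c' (a₀ , b') → (c' , a₀ , b') ∷ (c' , a + 1ℤ , b') ∷ [])
                           (ℤ.*-identityʳ c) (cong₂ _,_ (ℤ.+-identityʳ a) (ℤ.+-identityʳ b)))

  reduce : ∀ c a b → monomial c a b ∼ monomial (re (c · ξ^ a)) 0ℤ b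
  reduce c a b = ℤ-induction {λ a → ∀ c → monomial c a b ∼ monomial (re (c · ξ^ a)) 0ℤ b} base up down a c
    where
    same-value : ∀ {x y} → x ≡ y → monomial (re x) 0ℤ b ∼ monomial (re y) 0ℤ b
    same-value x≡y = ≗ᶜ⇒∼ (λ i j → cong (λ x → coeff (monomial (re x) 0ℤ b) i j) x≡y)
    base : ∀ c → monomial c 0ℤ b ∼ monomial (re (c · 1ᴱ)) 0ℤ b
    base c = ≗ᶜ⇒∼ (λ i j → cong (λ k → coeff (monomial k 0ℤ b) i j) (sym (ℤ.*-identityʳ c)))
    up : ∀ a → (∀ c → monomial c a b ∼ monomial (re (c · ξ^ a)) 0ℤ b) →
               ∀ c → monomial c (a + 1ℤ) b ∼ monomial (re (c · ξ^ (a + 1ℤ))) 0ℤ b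
    up a reduce-a c = ∼-trans (head∼⊖tail-swapped (c , a , b) (c , a + 1ℤ , b) [] (ψ-relation c a b))
      (∼-trans (reduce-a (- c)) (same-value (trans (neg-·≡·-1ᴱ*ᴱ c (ξ^ a)) (cong (c ·_) (sym (ξ^-suc a))))))
    down : ∀ a → (∀ c → monomial c (a + 1ℤ) b ∼ monomial (re (c · ξ^ (a + 1ℤ))) 0ℤ b) →
                 ∀ c → monomial c a b ∼ monomial (re (c · ξ^ a)) 0ℤ b
    down a reduce-a+1 c = ∼-trans (head∼⊖tail (c , a , b) ((c , a + 1ℤ , b) ∷ []) (ψ-relation c a b))
      (∼-trans (reduce-a+1 (- c)) (same-value (trans (cong ((- c) ·_) (ξ^-suc a))
        (trans (neg-·≡·-1ᴱ*ᴱ c (-1ᴱ *ᴱ ξ^ a)) (cong (c ·_) (undo (ξ^ a)))))))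
      where
      undo : ∀ x → -1ᴱ *ᴱ (-1ᴱ *ᴱ x) ≡ x
      undo x = trans (sym (*ᴱ-assoc -1ᴱ -1ᴱ x)) (*ᴱ-identityˡ x)

module XReduction₃ (n : ℕ∞) where
  open Quotient (fin 3) n
  open IntegerPowers ω ω̄ refl

  ψ-relation : ∀ c a b → InIdeal (fin 3) n ((c , a , b) ∷ (c , a + 1ℤ , b) ∷ (c , a + 1ℤ + 1ℤ , b) ∷ [])
  ψ-relation c a b = monomial c a b , [] , λ i j → cong (λ p → coeff p i j) expansion
    where
    expansion : (c , a , b) ∷ (c , a + 1ℤ , b) ∷ (c , a + 1ℤ + 1ℤ , b) ∷ []
              ≡ (monomial c a b ⊗ ψX (fin 3)) ⊕ ([] ⊗ ψY n)
    expansion = sym (cong₂ (λ c' (a₀ , a₂ , b') → (c' , a₀ , b') ∷ (c' , a + 1ℤ , b') ∷ (c' , a₂ , b') ∷ [])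
      (ℤ.*-identityʳ c) (cong₂ _,_ (ℤ.+-identityʳ a) (cong₂ _,_ (sym (ℤ.+-assoc a 1ℤ 1ℤ)) (ℤ.+-identityʳ b))))

  Reduces : ℤ → ℤ → Set
  Reduces b a = ∀ c → monomial c a b ∼ reduced (c · ξ^ a) b

  reduce : ∀ c a b → monomial c a b ∼ reduced (c · ξ^ a) b
  reduce c a b = ℤ-induction₂ {Reduces b} base₀ base₁ up down a c
    where
    combine : ∀ {f a₁ a₂ z} c → f ∼ monomial (- c) a₁ b ++ monomial (- c) a₂ b →
              (- c) · ξ^ a₁ +ᴱ (- c) · ξ^ a₂ ≡ z → Reduces b a₁ → Reduces b a₂ → f ∼ reduced z b
    combine {a₁ = a₁} {a₂} c f∼ sum≡z reduces₁ reduces₂ =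
      ∼-trans f∼ (∼-trans (∼-++ (reduces₁ (- c)) (reduces₂ (- c))) (≗ᶜ⇒∼ λ i j →
        trans (coeff-reduced-+ᴱ ((- c) · ξ^ a₁) ((- c) · ξ^ a₂) b i j)
              (cong (λ z → coeff (reduced z b) i j) sum≡z)))
    base₀ : Reduces b 0ℤ
    base₀ c = ≗ᶜ⇒∼ λ i j → sym (trans
      (cong₂ (λ x y → coeff ((x , 0ℤ , b) ∷ (y , 1ℤ , b) ∷ []) i j) (ℤ.*-identityʳ c) (ℤ.*-zeroʳ c))
      (cong (λ k → termCoeff (c , 0ℤ , b) i j + k) (coeff-∷-zero 1ℤ b [] i j)))
    base₁ : Reduces b 1ℤ
    base₁ c = ≗ᶜ⇒∼ λ i j → sym (trans
      (cong₂ (λ x y → coeff ((x , 0ℤ , b) ∷ (y , 1ℤ , b) ∷ []) i j) (ℤ.*-zeroʳ c) (ℤ.*-identityʳ c))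
      (coeff-∷-zero 0ℤ b ((c , 1ℤ , b) ∷ []) i j))
    ξ^-suc² : ∀ a → ξ^ (a + 1ℤ + 1ℤ) ≡ ω *ᴱ (ω *ᴱ ξ^ a)
    ξ^-suc² a = trans (ξ^-suc (a + 1ℤ)) (cong (ω *ᴱ_) (ξ^-suc a))
    up : ∀ a → Reduces b a → Reduces b (a + 1ℤ) → Reduces b (a + 1ℤ + 1ℤ)
    up a reduces-a reduces-a+1 c =
      combine c (head∼⊖tail t₂ (t₀ ∷ t₁ ∷ [])
                  (InIdeal-cong (t₀ ∷ t₁ ∷ t₂ ∷ []) (t₂ ∷ t₀ ∷ t₁ ∷ []) rotate
                                                           (ψ-relation c a b)))
        (trans (cong (λ x → (- c) · ξ^ a +ᴱ (- c) · x) (ξ^-suc a))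
               (trans (ω²-from-1+ω c (ξ^ a)) (cong (c ·_) (sym (ξ^-suc² a)))))
        reduces-a reduces-a+1
      where
      t₀ = (c , a , b)
      t₁ = (c , a + 1ℤ , b)
      t₂ = (c , a + 1ℤ + 1ℤ , b)
      rotate : (t₀ ∷ t₁ ∷ t₂ ∷ []) ≗ᶜ (t₂ ∷ t₀ ∷ t₁ ∷ [])
      rotate i j = trans (cong (λ k → termCoeff t₀ i j + k) (coeff-∷-comm t₁ t₂ [] i j))
                         (coeff-∷-comm t₀ t₂ (t₁ ∷ []) i j)
    down : ∀ a → Reduces b (a + 1ℤ) → Reduces b (a + 1ℤ + 1ℤ) → Reduces b a
    down a reduces-a+1 reduces-a+2 c =
      combine c (head∼⊖tail (c , a , b) ((c , a + 1ℤ , b) ∷ (c , a + 1ℤ + 1ℤ , b) ∷ []) (ψ-relation c a b))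
        (trans (cong₂ (λ x y → (- c) · x +ᴱ (- c) · y) (ξ^-suc a) (ξ^-suc² a)) (1-from-ω+ω² c (ξ^ a)))
        reduces-a+1 reduces-a+2

-- S_{2,3} and S_{3,3} through ring maps to ℤ[ω]

character : (ℤ → 𝔼) → (ℤ → 𝔼) → ℤ → ℤ → 𝔼
character χ ψ a b = χ a *ᴱ ψ b

character-+ : ∀ χ ψ → (∀ a a' → χ (a + a') ≡ χ a *ᴱ χ a') → (∀ b b' → ψ (b + b') ≡ ψ b *ᴱ ψ b') →
  ∀ a b a' b' → character χ ψ (a + a') (b + b') ≡ character χ ψ a b *ᴱ character χ ψ a' b'
character-+ χ ψ χ-+ ψ-+ a b a' b' =
  trans (cong₂ _*ᴱ_ (χ-+ a a') (ψ-+ b b')) (*ᴱ-interchange (χ a) (χ a') (ψ b) (ψ b'))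

module Multiplicative (e : ℤ → ℤ → 𝔼) (e-+ : ∀ a b a' b' → e (a + a') (b + b') ≡ e a b *ᴱ e a' b') where

  eval-map-termMul : ∀ c a b q → eval e (map (termMul (c , a , b)) q) ≡ (c · e a b) *ᴱ eval e q
  eval-map-termMul c a b [] = sym (*ᴱ-zeroʳ (c · e a b))
  eval-map-termMul c a b ((d , a' , b') ∷ q) =
    trans (cong₂ _+ᴱ_ (trans (cong ((c * d) ·_) (e-+ a b a' b')) (·-*ᴱ-interchange c d (e a b) (e a' b')))
                      (eval-map-termMul c a b q))
          (sym (*ᴱ-distribˡ-+ᴱ (c · e a b) (d · e a' b') (eval e q)))

  eval-⊗ : ∀ p q → eval e (p ⊗ q) ≡ eval e p *ᴱ eval e q
  eval-⊗ [] q = sym (*ᴱ-zeroˡ (eval e q))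
  eval-⊗ ((c , a , b) ∷ p) q =
    trans (eval-++ e (map (termMul (c , a , b)) q) (p ⊗ q))
      (trans (cong₂ _+ᴱ_ (eval-map-termMul c a b q) (eval-⊗ p q))
             (sym (*ᴱ-distribʳ-+ᴱ (eval e q) (c · e a b) (eval e p))))

  eval-⊗-vanishing : ∀ {ψ} → eval e ψ ≡ 0ᴱ → ∀ A → eval e (A ⊗ ψ) ≡ 0ᴱ
  eval-⊗-vanishing {ψ} ψ↦0 A = trans (eval-⊗ A ψ) (trans (cong (eval e A *ᴱ_) ψ↦0) (*ᴱ-zeroʳ (eval e A)))

  eval-IsUnit : ∀ {m n} → (∀ {f g} → Quotient._∼_ m n f g → eval e f ≡ eval e g) → e 0ℤ 0ℤ ≡ 1ᴱ →
    ∀ {u} → IsUnit m n u → IsSignedPowerOfω (eval e u)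
  eval-IsUnit eval-∼ e00≡1 {u} (v , uv≈1) = unit⇒signedPowerOfω (eval e u) (eval e v) (begin
    eval e u *ᴱ eval e v    ≡⟨ eval-⊗ u v ⟨
    eval e (u ⊗ v)          ≡⟨ eval-∼ {u ⊗ v} {one} (Quotient.by-ideal uv≈1) ⟩
    eval e one              ≡⟨ +ᴱ-identityʳ (1ℤ · e 0ℤ 0ℤ) ⟩
    1ℤ · e 0ℤ 0ℤ            ≡⟨ ·-identityˡ (e 0ℤ 0ℤ) ⟩
    e 0ℤ 0ℤ                 ≡⟨ e00≡1 ⟩
    1ᴱ                      ∎)
    where open ≡-Reasoning

module Case₂₃ where

  open Quotient (fin 2) (fin 3)
  module −1^ = IntegerPowers -1ᴱ -1ᴱ refl
  module ω^ = IntegerPowers ω ω̄ refl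

  e : ℤ → ℤ → 𝔼
  e = character −1^.ξ^ ω^.ξ^

  open Multiplicative e (character-+ −1^.ξ^ ω^.ξ^ −1^.ξ^-+ ω^.ξ^-+)

  embed : 𝔼 → LPoly
  embed z = reducedY z 0ℤ

  eval-embed : ∀ z → eval e (embed z) ≡ z
  eval-embed (a +ω b) = +ω-cong (re-part a b) (im-part a b)
    where
    re-part : ∀ a b → a * 1ℤ + (b * 0ℤ + 0ℤ) ≡ a
    re-part = solve-∀
    im-part : ∀ a b → a * 0ℤ + (b * 1ℤ + 0ℤ) ≡ b
    im-part = solve-∀

  eval-∼₂₃ : ∀ {f g} → f ∼ g → eval e f ≡ eval e g
  eval-∼₂₃ = eval-∼ e (eval-⊗-vanishing refl) (eval-⊗-vanishing refl)

  normal-form : ∀ w → w ∼ embed (eval e w)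
  normal-form w = ∼-trans w∼R (≗ᶜ⇒∼ λ i j → trans (R≗embed i j) (cong (λ z → coeff (embed z) i j) sum≡eval))
    where
    reducedValue : Term → 𝔼
    reducedValue (c , a , b) = re (c · −1^.ξ^ a) · ω^.ξ^ b
    reduce-term : ∀ t → (t ∷ []) ∼ embed (reducedValue t)
    reduce-term (c , a , b) = ∼-trans (XReduction₂.reduce (fin 3) c a b)
                                      (∼-swapVars (XReduction₃.reduce (fin 2) (re (c · −1^.ξ^ a)) b 0ℤ))
    R = concatMap (embed ∘ reducedValue) w
    Σvalues = sumBy _+ᴱ_ 0ᴱ reducedValue w
    w∼R : w ∼ R
    w∼R = ∼-concatMap (embed ∘ reducedValue) reduce-term w
    R≗embed : R ≗ᶜ embed Σvalues
    R≗embed = coeff-concatMap-additive _+ᴱ_ 0ᴱ embed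
      (λ x y → coeff-reducedY-+ᴱ x y 0ℤ) (coeff-reducedY-0ᴱ 0ℤ) reducedValue w
    sum≡eval : Σvalues ≡ eval e w
    sum≡eval = sym (trans (eval-∼₂₃ w∼R) (trans (eval-cong e R (embed Σvalues) R≗embed) (eval-embed Σvalues)))

  eval-injective : ∀ {f g} → eval e f ≡ eval e g → f ∼ g
  eval-injective {f} {g} ef≡eg = by-ideal (∼-vanishing⇒InIdeal (normal-form (f ⊕ (⊖ g)))
    (λ i j → trans (cong (λ z → coeff (embed z) i j) eval≡0) (coeff-reducedY-0ᴱ 0ℤ i j)))
    where
    eval≡0 : eval e (f ⊕ (⊖ g)) ≡ 0ᴱ
    eval≡0 = trans (eval-⊕⊖ e f g) (trans (cong (_+ᴱ -ᴱ eval e g) ef≡eg) (+ᴱ-inverseʳ (eval e g)))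

  eval-monomial : ∀ s (k : Fin 3) → eval e (monomial s 0ℤ (+ toℕ k)) ≡ s · ω ^ toℕ k
  eval-monomial s k = trans (+ᴱ-identityʳ (s · (1ᴱ *ᴱ ω ^ toℕ k))) (cong (s ·_) (*ᴱ-identityˡ (ω ^ toℕ k)))

  isUnit⇒signedMonomial : ∀ u → IsUnit (fin 2) (fin 3) u → IsSignedMonomial (fin 2) (fin 3) u
  isUnit⇒signedMonomial u u-unit = monomial-of-value (eval-IsUnit eval-∼₂₃ refl u-unit)
    where
    monomial-of-value : IsSignedPowerOfω (eval e u) → IsSignedMonomial (fin 2) (fin 3) u
    monomial-of-value (s , k , s-sign , eu≡) = s , 0ℤ , + toℕ k , s-sign , difference∈I u∼
      where
      evals : eval e u ≡ eval e (monomial s 0ℤ (+ toℕ k))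
      evals = trans eu≡ (sym (eval-monomial s k))
      u∼ : u ∼ monomial s 0ℤ (+ toℕ k)
      u∼ = eval-injective evals

module Case₃₃ where

  open Quotient (fin 3) (fin 3)
  open IntegerPowers ω ω̄ refl

  conj-ξ^-+ : ∀ b b' → conj (ξ^ (b + b')) ≡ conj (ξ^ b) *ᴱ conj (ξ^ b')
  conj-ξ^-+ b b' = trans (cong conj (ξ^-+ b b')) (conj-*ᴱ (ξ^ b) (ξ^ b'))

  e₁ e₂ : ℤ → ℤ → 𝔼
  e₁ = character ξ^ ξ^
  e₂ = character ξ^ (conj ∘ ξ^)

  module E₁ = Multiplicative e₁ (character-+ ξ^ ξ^ ξ^-+ ξ^-+)
  module E₂ = Multiplicative e₂ (character-+ ξ^ (conj ∘ ξ^) ξ^-+ conj-ξ^-+)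

  eval₁-∼ : ∀ {f g} → f ∼ g → eval e₁ f ≡ eval e₁ g
  eval₁-∼ = eval-∼ e₁ (E₁.eval-⊗-vanishing refl) (E₁.eval-⊗-vanishing refl)

  eval₂-∼ : ∀ {f g} → f ∼ g → eval e₂ f ≡ eval e₂ g
  eval₂-∼ = eval-∼ e₂ (E₂.eval-⊗-vanishing refl) (E₂.eval-⊗-vanishing refl)

  -- u + v x, with u and v written in the basis 1, y
  normal : 𝔼 × 𝔼 → LPoly
  normal (u , v) = reducedY u 0ℤ ++ reducedY v 1ℤ

  _⊹_ : 𝔼 × 𝔼 → 𝔼 × 𝔼 → 𝔼 × 𝔼
  (u , v) ⊹ (u' , v') = u +ᴱ u' , v +ᴱ v'

  coeff-normal-⊹ : ∀ p q → (normal p ++ normal q) ≗ᶜ normal (p ⊹ q)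
  coeff-normal-⊹ (u , v) (u' , v') i j = begin
    coeff ((U ++ V) ++ (U' ++ V')) i j
      ≡⟨ coeff-++ (U ++ V) (U' ++ V') i j ⟩
    coeff (U ++ V) i j + coeff (U' ++ V') i j
      ≡⟨ cong₂ _+_ (coeff-++ U V i j) (coeff-++ U' V' i j) ⟩
    (coeff U i j + coeff V i j) + (coeff U' i j + coeff V' i j)
      ≡⟨ interchange (coeff U i j) (coeff V i j) (coeff U' i j) (coeff V' i j) ⟩
    (coeff U i j + coeff U' i j) + (coeff V i j + coeff V' i j)
      ≡⟨ cong₂ _+_ (sym (coeff-++ U U' i j)) (sym (coeff-++ V V' i j)) ⟩
    coeff (U ++ U') i j + coeff (V ++ V') i j
      ≡⟨ cong₂ _+_ (coeff-reducedY-+ᴱ u u' 0ℤ i j) (coeff-reducedY-+ᴱ v v' 1ℤ i j) ⟩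
    coeff (reducedY (u +ᴱ u') 0ℤ) i j + coeff (reducedY (v +ᴱ v') 1ℤ) i j
      ≡⟨ coeff-++ (reducedY (u +ᴱ u') 0ℤ) (reducedY (v +ᴱ v') 1ℤ) i j ⟨
    coeff (normal ((u , v) ⊹ (u' , v'))) i j ∎
    where
    open ≡-Reasoning
    U = reducedY u 0ℤ
    V = reducedY v 1ℤ
    U' = reducedY u' 0ℤ
    V' = reducedY v' 1ℤ
    interchange : ∀ a b c d → (a + b) + (c + d) ≡ (a + c) + (b + d)
    interchange = solve-∀

  coeff-normal-0 : ∀ i j → coeff (normal (0ᴱ , 0ᴱ)) i j ≡ 0ℤ
  coeff-normal-0 i j = trans (coeff-++ (reducedY 0ᴱ 0ℤ) (reducedY 0ᴱ 1ℤ) i j)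
    (cong₂ _+_ (coeff-reducedY-0ᴱ 0ℤ i j) (coeff-reducedY-0ᴱ 1ℤ i j))

  normal-form : ∀ w → Σ (𝔼 × 𝔼) λ p → w ∼ normal p
  normal-form w = sumBy _⊹_ (0ᴱ , 0ᴱ) reducedValue w ,
    ∼-trans (∼-concatMap (normal ∘ reducedValue) reduce-term w)
            (≗ᶜ⇒∼ (coeff-concatMap-additive _⊹_ (0ᴱ , 0ᴱ) normal coeff-normal-⊹ coeff-normal-0 reducedValue w))
    where
    reducedValue : Term → 𝔼 × 𝔼
    reducedValue (c , a , b) = re (c · ξ^ a) · ξ^ b , im (c · ξ^ a) · ξ^ b
    reduce-term : ∀ t → (t ∷ []) ∼ normal (reducedValue t)
    reduce-term (c , a , b) = ∼-trans (XReduction₃.reduce (fin 3) c a b)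
      (∼-++ (∼-swapVars (XReduction₃.reduce (fin 3) (re (c · ξ^ a)) b 0ℤ))
            (∼-swapVars (XReduction₃.reduce (fin 3) (im (c · ξ^ a)) b 1ℤ)))

  eval₁-normal : ∀ u v → eval e₁ (normal (u , v)) ≡ u +ᴱ ω *ᴱ v
  eval₁-normal (a +ω b) (c +ω d) = +ω-cong (re-part a b c d) (im-part a b c d)
    where
    re-part : ∀ a b c d → a * 1ℤ + (b * 0ℤ + (c * 0ℤ + (d * -1ℤ + 0ℤ))) ≡ a + (0ℤ * c - 1ℤ * d)
    re-part = solve-∀
    im-part : ∀ a b c d → a * 0ℤ + (b * 1ℤ + (c * 1ℤ + (d * -1ℤ + 0ℤ))) ≡ b + ((0ℤ * d + 1ℤ * c) - 1ℤ * d)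
    im-part = solve-∀

  eval₂-normal : ∀ u v → eval e₂ (normal (u , v)) ≡ conj u +ᴱ ω *ᴱ conj v
  eval₂-normal (a +ω b) (c +ω d) = +ω-cong (re-part a b c d) (im-part a b c d)
    where
    re-part : ∀ a b c d → a * 1ℤ + (b * -1ℤ + (c * 0ℤ + (d * 1ℤ + 0ℤ)))
                       ≡ (a - b) + (0ℤ * (c - d) - 1ℤ * (- d))
    re-part = solve-∀
    im-part : ∀ a b c d → a * 0ℤ + (b * -1ℤ + (c * 1ℤ + (d * 0ℤ + 0ℤ)))
                       ≡ (- b) + ((0ℤ * (- d) + 1ℤ * (c - d)) - 1ℤ * (- d))
    im-part = solve-∀

  evals-vanish⇒0 : ∀ u v → u +ᴱ ω *ᴱ v ≡ 0ᴱ → conj u +ᴱ ω *ᴱ conj v ≡ 0ᴱ → u ≡ 0ᴱ × v ≡ 0ᴱ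
  evals-vanish⇒0 (a +ω b) (c +ω d) e₁≡0 e₂≡0 = +ω-cong a≡0 b≡0 , +ω-cong c≡0 d≡0
    where
    h₁ : a - d ≡ 0ℤ
    h₁ = trans (simplify a c d) (cong re e₁≡0)
      where
      simplify : ∀ a c d → a - d ≡ a + (0ℤ * c - 1ℤ * d)
      simplify = solve-∀
    h₂ : b + c - d ≡ 0ℤ
    h₂ = trans (simplify b c d) (cong im e₁≡0)
      where
      simplify : ∀ b c d → b + c - d ≡ b + ((0ℤ * d + 1ℤ * c) - 1ℤ * d)
      simplify = solve-∀
    h₃ : a - b + d ≡ 0ℤ
    h₃ = trans (simplify a b c d) (cong re e₂≡0)
      where
      simplify : ∀ a b c d → a - b + d ≡ (a - b) + (0ℤ * (c - d) - 1ℤ * (- d))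
      simplify = solve-∀
    h₄ : c - b ≡ 0ℤ
    h₄ = trans (simplify b c d) (cong im e₂≡0)
      where
      simplify : ∀ b c d → c - b ≡ (- b) + ((0ℤ * (- d) + 1ℤ * (c - d)) - 1ℤ * (- d))
      simplify = solve-∀
    b≡0 : b ≡ 0ℤ
    b≡0 = ℤ.*-cancelˡ-≡ (+ 3) b 0ℤ
      (trans (combine a b c d) (cong₂ (λ x y → + 2 * x - y) (cong₂ _-_ h₂ h₄) (cong₂ _-_ h₁ h₃)))
      where
      combine : ∀ a b c d → + 3 * b ≡ + 2 * ((b + c - d) - (c - b)) - ((a - d) - (a - b + d))
      combine = solve-∀
    c≡0 : c ≡ 0ℤ
    c≡0 = trans (ℤ.i-j≡0⇒i≡j c b h₄) b≡0
    d≡0 : d ≡ 0ℤ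
    d≡0 = trans (combine b c d) (trans (cong₂ (λ x y → x + y - (b + c - d)) b≡0 c≡0) (cong (λ x → 0ℤ - x) h₂))
      where
      combine : ∀ b c d → d ≡ b + c - (b + c - d)
      combine = solve-∀
    a≡0 : a ≡ 0ℤ
    a≡0 = trans (ℤ.i-j≡0⇒i≡j a d h₁) d≡0

  eval-injective : ∀ {f g} → eval e₁ f ≡ eval e₁ g → eval e₂ f ≡ eval e₂ g → f ∼ g
  eval-injective {f} {g} e₁f≡e₁g e₂f≡e₂g = from-normal-form (normal-form (f ⊕ (⊖ g)))
    where
    difference-vanishes : ∀ e → eval e f ≡ eval e g → eval e (f ⊕ (⊖ g)) ≡ 0ᴱ
    difference-vanishes e ef≡eg =
      trans (eval-⊕⊖ e f g) (trans (cong (_+ᴱ -ᴱ eval e g) ef≡eg) (+ᴱ-inverseʳ (eval e g)))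
    from-normal-form : (Σ (𝔼 × 𝔼) λ p → (f ⊕ (⊖ g)) ∼ normal p) → f ∼ g
    from-normal-form ((u , v) , d∼) = by-ideal (∼-vanishing⇒InIdeal d∼ normal≡0)
      where
      u,v≡0 : u ≡ 0ᴱ × v ≡ 0ᴱ
      u,v≡0 = evals-vanish⇒0 u v
        (trans (sym (eval₁-normal u v)) (trans (sym (eval₁-∼ d∼)) (difference-vanishes e₁ e₁f≡e₁g)))
        (trans (sym (eval₂-normal u v)) (trans (sym (eval₂-∼ d∼)) (difference-vanishes e₂ e₂f≡e₂g)))
      normal≡0 : ∀ i j → coeff (normal (u , v)) i j ≡ 0ℤ
      normal≡0 i j = trans (cong₂ (λ u v → coeff (normal (u , v)) i j) (proj₁ u,v≡0) (proj₂ u,v≡0)) (coeff-normal-0 i j)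

  -- reduction modulo 1 - ω, i.e. ω ↦ 1
  re+im : 𝔼 → ℤ
  re+im (a +ω b) = a + b

  re+im-signedPower : ∀ s (k : Fin 3) → + 3 ∣ re+im (s · ω ^ toℕ k) - s
  re+im-signedPower s zero = divides 0ℤ (exact s)
    where
    exact : ∀ s → s * 1ℤ + s * 0ℤ - s ≡ 0ℤ * + 3
    exact = solve-∀
  re+im-signedPower s (suc zero) = divides 0ℤ (exact s)
    where
    exact : ∀ s → s * 0ℤ + s * 1ℤ - s ≡ 0ℤ * + 3
    exact = solve-∀
  re+im-signedPower s (suc (suc zero)) = divides (- s) (exact s)
    where
    exact : ∀ s → s * -1ℤ + s * -1ℤ - s ≡ (- s) * + 3
    exact = solve-∀

  re+im-evals : ∀ w → + 3 ∣ re+im (eval e₁ w) - re+im (eval e₂ w)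
  re+im-evals w = from-normal-form (normal-form w)
    where
    difference : ∀ a b c d → (a + (0ℤ * c - 1ℤ * d)) + (b + ((0ℤ * d + 1ℤ * c) - 1ℤ * d))
      - (((a - b) + (0ℤ * (c - d) - 1ℤ * (- d))) + ((- b) + ((0ℤ * (- d) + 1ℤ * (c - d)) - 1ℤ * (- d))))
      ≡ (b - d) * + 3
    difference = solve-∀
    from-normal-form : (Σ (𝔼 × 𝔼) λ p → w ∼ normal p) → + 3 ∣ re+im (eval e₁ w) - re+im (eval e₂ w)
    from-normal-form ((u , v) , w∼) = divides (im u - im v) (begin
      re+im (eval e₁ w) - re+im (eval e₂ w)
        ≡⟨ cong₂ (λ x y → re+im x - re+im y) (trans (eval₁-∼ w∼) (eval₁-normal u v))
                                               (trans (eval₂-∼ w∼) (eval₂-normal u v)) ⟩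
      re+im (u +ᴱ ω *ᴱ v) - re+im (conj u +ᴱ ω *ᴱ conj v)
        ≡⟨ difference (re u) (im u) (re v) (im v) ⟩
      (im u - im v) * + 3 ∎)
      where open ≡-Reasoning

  signs-agree : ∀ {s₁ s₂} → IsSign s₁ → IsSign s₂ → + 3 ∣ s₁ - s₂ → s₁ ≡ s₂
  signs-agree (inj₁ refl) (inj₁ refl) _   = refl
  signs-agree (inj₂ refl) (inj₂ refl) _   = refl
  signs-agree (inj₁ refl) (inj₂ refl) 3∣2 with ℕ.∣⇒≤ (∣⇒∣ᵤ 3∣2)
  ... | s≤s (s≤s ())
  signs-agree (inj₂ refl) (inj₁ refl) 3∣2 with ℕ.∣⇒≤ (∣⇒∣ᵤ 3∣2)
  ... | s≤s (s≤s ())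

  -- solving i + j ≡ k₁, i - j ≡ k₂ (mod 3)
  exponents : ∀ (k₁ k₂ : Fin 3) → Σ ℤ λ i → Σ ℤ λ j → e₁ i j ≡ ω ^ toℕ k₁ × e₂ i j ≡ ω ^ toℕ k₂
  exponents zero             zero             = + 0 , + 0 , refl , refl
  exponents zero             (suc zero)       = + 2 , + 1 , refl , refl
  exponents zero             (suc (suc zero)) = + 1 , + 2 , refl , refl
  exponents (suc zero)       zero             = + 2 , + 2 , refl , refl
  exponents (suc zero)       (suc zero)       = + 1 , + 0 , refl , refl
  exponents (suc zero)       (suc (suc zero)) = + 0 , + 1 , refl , refl
  exponents (suc (suc zero)) zero             = + 1 , + 1 , refl , refl
  exponents (suc (suc zero)) (suc zero)       = + 0 , + 2 , refl , refl
  exponents (suc (suc zero)) (suc (suc zero)) = + 2 , + 0 , refl , refl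

  isUnit⇒signedMonomial : ∀ u → IsUnit (fin 3) (fin 3) u → IsSignedMonomial (fin 3) (fin 3) u
  isUnit⇒signedMonomial u u-unit =
    monomial-of-values (E₁.eval-IsUnit eval₁-∼ refl u-unit) (E₂.eval-IsUnit eval₂-∼ refl u-unit)
    where
    monomial-of-values : IsSignedPowerOfω (eval e₁ u) → IsSignedPowerOfω (eval e₂ u) → IsSignedMonomial (fin 3) (fin 3) u
    monomial-of-values (s₁ , k₁ , s₁-sign , e₁u≡) (s₂ , k₂ , s₂-sign , e₂u≡) =
      s₁ , i , j , s₁-sign , difference∈I u∼
      where
      i = proj₁ (exponents k₁ k₂)
      j = proj₁ (proj₂ (exponents k₁ k₂))
      s₁≡s₂ : s₁ ≡ s₂
      s₁≡s₂ = signs-agree s₁-sign s₂-sign (subst (+ 3 ∣_) (telescope x y s₁ s₂)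
                (∣m∣n⇒∣m+n (∣m∣n⇒∣m-n (re+im-evals u) (at-sign e₁u≡ (re+im-signedPower s₁ k₁)))
                           (at-sign e₂u≡ (re+im-signedPower s₂ k₂))))
        where
        x = re+im (eval e₁ u)
        y = re+im (eval e₂ u)
        at-sign : ∀ {z s w} → z ≡ w → + 3 ∣ re+im w - s → + 3 ∣ re+im z - s
        at-sign refl 3∣ = 3∣
        telescope : ∀ x y s₁ s₂ → ((x - y) - (x - s₁)) + (y - s₂) ≡ s₁ - s₂
        telescope = solve-∀
      evals₁ : eval e₁ u ≡ eval e₁ (monomial s₁ i j)
      evals₁ = trans e₁u≡ (sym (trans (+ᴱ-identityʳ (s₁ · e₁ i j))
                                      (cong (s₁ ·_) (proj₁ (proj₂ (proj₂ (exponents k₁ k₂)))))))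
      evals₂ : eval e₂ u ≡ eval e₂ (monomial s₁ i j)
      evals₂ = trans e₂u≡ (sym (trans (+ᴱ-identityʳ (s₁ · e₂ i j))
                                      (cong₂ _·_ s₁≡s₂ (proj₂ (proj₂ (proj₂ (exponents k₁ k₂)))))))
      u∼ : u ∼ monomial s₁ i j
      u∼ = eval-injective evals₁ evals₂

-- S_{2,∞} and S_{3,∞} as Laurent polynomials in y over ℤ[ζ]

sumᴱ : (Term → 𝔼) → LPoly → 𝔼
sumᴱ = sumBy _+ᴱ_ 0ᴱ

sumᴱ-cong-on : ∀ {P : Term → Set} {f g} p → All P p → (∀ t → P t → f t ≡ g t) → sumᴱ f p ≡ sumᴱ g p
sumᴱ-cong-on []      []         f≗g = refl
sumᴱ-cong-on (t ∷ p) (pt ∷ pp) f≗g = cong₂ _+ᴱ_ (f≗g t pt) (sumᴱ-cong-on p pp f≗g)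

sumᴱ-cong : ∀ {f g} p → (∀ t → f t ≡ g t) → sumᴱ f p ≡ sumᴱ g p
sumᴱ-cong []      f≗g = refl
sumᴱ-cong (t ∷ p) f≗g = cong₂ _+ᴱ_ (f≗g t) (sumᴱ-cong p f≗g)

sumᴱ-zero : ∀ p → sumᴱ (λ _ → 0ᴱ) p ≡ 0ᴱ
sumᴱ-zero []      = refl
sumᴱ-zero (t ∷ p) = trans (cong (0ᴱ +ᴱ_) (sumᴱ-zero p)) (+ᴱ-identityˡ 0ᴱ)

sumᴱ-+ᴱ : ∀ p f g → sumᴱ (λ t → f t +ᴱ g t) p ≡ sumᴱ f p +ᴱ sumᴱ g p
sumᴱ-+ᴱ []      f g = sym (+ᴱ-identityˡ 0ᴱ)
sumᴱ-+ᴱ (t ∷ p) f g = trans (cong ((f t +ᴱ g t) +ᴱ_) (sumᴱ-+ᴱ p f g)) (interchange (f t) (g t) (sumᴱ f p) (sumᴱ g p))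
  where
  interchange : ∀ x y z w → (x +ᴱ y) +ᴱ (z +ᴱ w) ≡ (x +ᴱ z) +ᴱ (y +ᴱ w)
  interchange (a +ω b) (c +ω d) (e +ω f) (g +ω h) = +ω-cong (interchange-ℤ a c e g) (interchange-ℤ b d f h)
    where
    interchange-ℤ : ∀ a c e g → (a + c) + (e + g) ≡ (a + e) + (c + g)
    interchange-ℤ = solve-∀

*ᴱ-sumᴱ : ∀ p x f → x *ᴱ sumᴱ f p ≡ sumᴱ (λ t → x *ᴱ f t) p
*ᴱ-sumᴱ []      x f = *ᴱ-zeroʳ x
*ᴱ-sumᴱ (t ∷ p) x f = trans (*ᴱ-distribˡ-+ᴱ x (f t) (sumᴱ f p)) (cong (x *ᴱ f t +ᴱ_) (*ᴱ-sumᴱ p x f))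

sumᴱ-*ᴱ : ∀ p x f → sumᴱ f p *ᴱ x ≡ sumᴱ (λ t → f t *ᴱ x) p
sumᴱ-*ᴱ p x f = trans (*ᴱ-comm (sumᴱ f p) x) (trans (*ᴱ-sumᴱ p x f) (sumᴱ-cong p (λ t → *ᴱ-comm x (f t))))

sumᴱ-comm : ∀ p q (G : Term → Term → 𝔼) →
  sumᴱ (λ s → sumᴱ (G s) q) p ≡ sumᴱ (λ t → sumᴱ (λ s → G s t) p) q
sumᴱ-comm []       q G = sym (sumᴱ-zero q)
sumᴱ-comm (s ∷ p) q G = trans (cong (sumᴱ (G s) q +ᴱ_) (sumᴱ-comm p q G))
                               (sym (sumᴱ-+ᴱ q (G s) (λ t → sumᴱ (λ s → G s t) p)))

eval-as-sumᴱ : ∀ e p → eval e p ≡ sumᴱ (λ (c , a , b) → c · e a b) p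
eval-as-sumᴱ e []              = refl
eval-as-sumᴱ e ((c , a , b) ∷ p) = cong (c · e a b +ᴱ_) (eval-as-sumᴱ e p)

yExp : Term → ℤ
yExp (_ , _ , b) = b

below-argmax : ∀ t r → All (λ s → yExp s ≤ yExp (argmax yExp t r)) (t ∷ r)
below-argmax t r = f[⊥]≤f[argmax] {f = yExp} t r ∷ f[xs]≤f[argmax] {f = yExp} t r

above-argmin : ∀ t r → All (λ s → yExp (argmin yExp t r) ≤ yExp s) (t ∷ r)
above-argmin t r = f[argmin]≤f[⊤] {f = yExp} t r ∷ f[argmin]≤f[xs] {f = yExp} t r

⊗-[] : ∀ p → p ⊗ [] ≡ []
⊗-[] []      = refl
⊗-[] (t ∷ p) = ⊗-[] p

separated-≤ : ∀ {b b' d d'} → b ≤ d → b' ≤ d' → b + b' ≡ d + d' → b ≡ d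
separated-≤ {b} {b'} {d} {d'} b≤d b'≤d' sum≡ with b ≟ d
... | yes b≡d = b≡d
... | no b≢d  = ⊥-elim (ℤ.<-irrefl sum≡ (ℤ.+-mono-<-≤ (ℤ.≤∧≢⇒< b≤d b≢d) b'≤d'))

separated-≥ : ∀ {b b' d d'} → d ≤ b → d' ≤ b' → b + b' ≡ d + d' → b ≡ d
separated-≥ {b} {b'} {d} {d'} d≤b d'≤b' sum≡ with d ≟ b
... | yes d≡b = sym d≡b
... | no d≢b  = ⊥-elim (ℤ.<-irrefl (sym sum≡) (ℤ.+-mono-<-≤ (ℤ.≤∧≢⇒< d≤b d≢b) d'≤b'))

module Laurent (ξ ξ⁻¹ : 𝔼) (ξ*ξ⁻¹≡1 : ξ *ᴱ ξ⁻¹ ≡ 1ᴱ) where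
  open IntegerPowers ξ ξ⁻¹ ξ*ξ⁻¹≡1 public

  value : Term → 𝔼
  value (c , a , _) = c · ξ^ a

  atY : ℤ → ℤ → ℤ → 𝔼
  atY k a b = if ⌊ b ≟ k ⌋ then ξ^ a else 0ᴱ

  -- the coefficient of y^k, viewing ℤ[x^±,y^±] ⟶ ℤ[ξ][y^±]
  coeffʸ : ℤ → LPoly → 𝔼
  coeffʸ k = eval (atY k)

  valueAt : ℤ → Term → 𝔼
  valueAt k (c , a , b) = c · atY k a b

  coeffʸ-map-termMul : ∀ t q k → coeffʸ k (map (termMul t) q) ≡ value t *ᴱ coeffʸ (k - yExp t) q
  coeffʸ-map-termMul t [] k = sym (*ᴱ-zeroʳ (value t))
  coeffʸ-map-termMul (c , a , b) ((d , a' , b') ∷ q) k =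
    trans (cong₂ _+ᴱ_ head (coeffʸ-map-termMul (c , a , b) q k))
          (sym (*ᴱ-distribˡ-+ᴱ (c · ξ^ a) (d · atY (k - b) a' b') (coeffʸ (k - b) q)))
    where
    split : ∀ h → (c * d) · (if h then ξ^ (a + a') else 0ᴱ) ≡ (c · ξ^ a) *ᴱ (d · (if h then ξ^ a' else 0ᴱ))
    split true  = trans (cong ((c * d) ·_) (ξ^-+ a a')) (·-*ᴱ-interchange c d (ξ^ a) (ξ^ a'))
    split false = trans (·-zeroʳ (c * d)) (sym (trans (cong ((c · ξ^ a) *ᴱ_) (·-zeroʳ d)) (*ᴱ-zeroʳ (c · ξ^ a))))
    head : (c * d) · atY k (a + a') (b + b') ≡ (c · ξ^ a) *ᴱ (d · atY (k - b) a' b')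
    head = trans (cong (λ h → (c * d) · (if h then ξ^ (a + a') else 0ᴱ))
                       (trans (cong (λ x → ⌊ x ≟ k ⌋) (ℤ.+-comm b b')) (⌊+≟⌋≡⌊≟-⌋ b' b k)))
                 (split ⌊ b' ≟ k - b ⌋)

  coeffʸ-⊗ : ∀ p q k → coeffʸ k (p ⊗ q) ≡ sumᴱ (λ t → value t *ᴱ coeffʸ (k - yExp t) q) p
  coeffʸ-⊗ []      q k = refl
  coeffʸ-⊗ (t ∷ p) q k = trans (eval-++ (atY k) (map (termMul t) q) (p ⊗ q))
                               (cong₂ _+ᴱ_ (coeffʸ-map-termMul t q k) (coeffʸ-⊗ p q k))

  coeffʸ-⊗-comm : ∀ p q k → coeffʸ k (p ⊗ q) ≡ coeffʸ k (q ⊗ p)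
  coeffʸ-⊗-comm p q k = begin
    coeffʸ k (p ⊗ q)
      ≡⟨ trans (coeffʸ-⊗ p q k) (double-sum p q) ⟩
    sumᴱ (λ s → sumᴱ (G s) q) p
      ≡⟨ sumᴱ-comm p q G ⟩
    sumᴱ (λ t → sumᴱ (λ s → G s t) p) q
      ≡⟨ sumᴱ-cong q (λ t → sumᴱ-cong p (λ s → G-symmetric s t)) ⟩
    sumᴱ (λ t → sumᴱ (G t) p) q
      ≡⟨ trans (coeffʸ-⊗ q p k) (double-sum q p) ⟨
    coeffʸ k (q ⊗ p) ∎
    where
    open ≡-Reasoning
    G : Term → Term → 𝔼
    G s t = value s *ᴱ valueAt (k - yExp s) t
    double-sum : ∀ p q → sumᴱ (λ s → value s *ᴱ coeffʸ (k - yExp s) q) p ≡ sumᴱ (λ s → sumᴱ (G s) q) p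
    double-sum p q = sumᴱ-cong p (λ s → trans (cong (value s *ᴱ_) (eval-as-sumᴱ (atY (k - yExp s)) q))
                                            (*ᴱ-sumᴱ q (value s) (valueAt (k - yExp s))))
    swap-if : ∀ h c d x y → (c · x) *ᴱ (d · (if h then y else 0ᴱ)) ≡ (d · y) *ᴱ (c · (if h then x else 0ᴱ))
    swap-if true  c d x y = *ᴱ-comm (c · x) (d · y)
    swap-if false c d x y = trans (cong ((c · x) *ᴱ_) (·-zeroʳ d))
      (trans (*ᴱ-zeroʳ (c · x)) (sym (trans (cong ((d · y) *ᴱ_) (·-zeroʳ c)) (*ᴱ-zeroʳ (d · y)))))
    G-symmetric : ∀ s t → G s t ≡ G t s
    G-symmetric (c , a , b) (d , a' , b') =
      trans (cong (λ h → (c · ξ^ a) *ᴱ (d · (if h then ξ^ a' else 0ᴱ))) (sym (⌊+≟⌋≡⌊≟-⌋ b' b k)))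
      (trans (cong (λ x → (c · ξ^ a) *ᴱ (d · (if ⌊ x ≟ k ⌋ then ξ^ a' else 0ᴱ))) (ℤ.+-comm b' b))
      (trans (swap-if ⌊ b + b' ≟ k ⌋ c d (ξ^ a) (ξ^ a'))
             (cong (λ h → (d · ξ^ a') *ᴱ (c · (if h then ξ^ a else 0ᴱ))) (⌊+≟⌋≡⌊≟-⌋ b b' k))))

  coeffʸ-⊗-cong : ∀ p p' q q' → (∀ j → coeffʸ j p ≡ coeffʸ j p') → (∀ j → coeffʸ j q ≡ coeffʸ j q') →
    ∀ k → coeffʸ k (p ⊗ q) ≡ coeffʸ k (p' ⊗ q')
  coeffʸ-⊗-cong p p' q q' p≗p' q≗q' k = begin
    coeffʸ k (p ⊗ q)    ≡⟨ right-cong p q≗q' ⟩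
    coeffʸ k (p ⊗ q')   ≡⟨ coeffʸ-⊗-comm p q' k ⟩
    coeffʸ k (q' ⊗ p)   ≡⟨ right-cong q' p≗p' ⟩
    coeffʸ k (q' ⊗ p')  ≡⟨ coeffʸ-⊗-comm q' p' k ⟩
    coeffʸ k (p' ⊗ q')  ∎
    where
    open ≡-Reasoning
    right-cong : ∀ r {s s'} → (∀ j → coeffʸ j s ≡ coeffʸ j s') → coeffʸ k (r ⊗ s) ≡ coeffʸ k (r ⊗ s')
    right-cong r {s} {s'} s≗s' = trans (coeffʸ-⊗ r s k)
      (trans (sumᴱ-cong r (λ t → cong (value t *ᴱ_) (s≗s' (k - yExp t)))) (sym (coeffʸ-⊗ r s' k)))

  coeffʸ-vanishes : ∀ j w → All (λ t → yExp t ≢ j) w → coeffʸ j w ≡ 0ᴱ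
  coeffʸ-vanishes j []                []            = refl
  coeffʸ-vanishes j ((c , a , b) ∷ w) (b≢j ∷ rest) with b ≟ j
  ... | yes b≡j = ⊥-elim (b≢j b≡j)
  ... | no _    = trans (cong₂ _+ᴱ_ (·-zeroʳ c) (coeffʸ-vanishes j w rest)) (+ᴱ-identityˡ 0ᴱ)

  coeffʸ-⊗-extreme : ∀ {_⊑_ : ℤ → ℤ → Set} p q d₁ d₂ →
    (∀ {b b'} → b ⊑ d₁ → b' ⊑ d₂ → b + b' ≡ d₁ + d₂ → b ≡ d₁) →
    All (λ t → yExp t ⊑ d₁) p → All (λ t → yExp t ⊑ d₂) q →
    coeffʸ (d₁ + d₂) (p ⊗ q) ≡ coeffʸ d₁ p *ᴱ coeffʸ d₂ q
  coeffʸ-⊗-extreme {_⊑_} p q d₁ d₂ separated p⊑d₁ q⊑d₂ = begin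
    coeffʸ (d₁ + d₂) (p ⊗ q)                              ≡⟨ coeffʸ-⊗ p q (d₁ + d₂) ⟩
    sumᴱ (λ t → value t *ᴱ coeffʸ (d₁ + d₂ - yExp t) q) p ≡⟨ sumᴱ-cong-on p p⊑d₁ term ⟩
    sumᴱ (λ t → valueAt d₁ t *ᴱ coeffʸ d₂ q) p            ≡⟨ sumᴱ-*ᴱ p (coeffʸ d₂ q) (valueAt d₁) ⟨
    sumᴱ (valueAt d₁) p *ᴱ coeffʸ d₂ q                    ≡⟨ cong (_*ᴱ coeffʸ d₂ q) (eval-as-sumᴱ (atY d₁) p) ⟨
    coeffʸ d₁ p *ᴱ coeffʸ d₂ q                            ∎
    where
    open ≡-Reasoning
    cancel : ∀ d₁ d₂ → d₁ + d₂ - d₁ ≡ d₂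
    cancel = solve-∀
    rearrange : ∀ b b' k → b' ≡ k - b → b + b' ≡ k
    rearrange b b' k b'≡ = trans (cong (λ k → b + k) b'≡) (add-back b k)
      where
      add-back : ∀ b k → b + (k - b) ≡ k
      add-back = solve-∀
    term : ∀ t → yExp t ⊑ d₁ → value t *ᴱ coeffʸ (d₁ + d₂ - yExp t) q ≡ valueAt d₁ t *ᴱ coeffʸ d₂ q
    term (c , a , b) b⊑d₁ with b ≟ d₁
    ... | yes refl = cong (λ k → (c · ξ^ a) *ᴱ coeffʸ k q) (cancel b d₂)
    ... | no b≢d₁ = trans (cong ((c · ξ^ a) *ᴱ_) (coeffʸ-vanishes (d₁ + d₂ - b) q
                            (All.map (λ b'⊑d₂ b'≡ → b≢d₁ (separated b⊑d₁ b'⊑d₂ (rearrange b _ (d₁ + d₂) b'≡)))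
                                     q⊑d₂)))
                    (trans (*ᴱ-zeroʳ (c · ξ^ a))
                           (sym (trans (cong (_*ᴱ coeffʸ d₂ q) (·-zeroʳ c)) (*ᴱ-zeroˡ (coeffʸ d₂ q)))))

  valueAt-miss : ∀ t j → yExp t ≢ j → valueAt j t ≡ 0ᴱ
  valueAt-miss (c , a , b) j b≢j with b ≟ j
  ... | yes b≡j = ⊥-elim (b≢j b≡j)
  ... | no _    = ·-zeroʳ c

  module Support (u : LPoly) where

    keep : LPoly → LPoly
    keep [] = []
    keep (t ∷ p) with coeffʸ (yExp t) u ≟ᴱ 0ᴱ
    ... | yes _ = keep p
    ... | no _  = t ∷ keep p

    keep-nonzero : ∀ p → All (λ t → coeffʸ (yExp t) u ≢ 0ᴱ) (keep p)
    keep-nonzero [] = []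
    keep-nonzero (t ∷ p) with coeffʸ (yExp t) u ≟ᴱ 0ᴱ
    ... | yes _  = keep-nonzero p
    ... | no ≢0  = ≢0 ∷ keep-nonzero p

    coeffʸ-keep : ∀ j → coeffʸ j u ≢ 0ᴱ → ∀ p → coeffʸ j (keep p) ≡ coeffʸ j p
    coeffʸ-keep j u≢0 [] = refl
    coeffʸ-keep j u≢0 (t@(c , a , b) ∷ p) with coeffʸ b u ≟ᴱ 0ᴱ
    ... | yes ≡0 = trans (coeffʸ-keep j u≢0 p)
      (sym (trans (cong (_+ᴱ coeffʸ j p) (valueAt-miss t j (λ { refl → u≢0 ≡0 }))) (+ᴱ-identityˡ (coeffʸ j p))))
    ... | no _   = cong (c · atY j a b +ᴱ_) (coeffʸ-keep j u≢0 p)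

    support : LPoly
    support = keep u

    coeffʸ-support : ∀ j → coeffʸ j support ≡ coeffʸ j u
    coeffʸ-support j with coeffʸ j u ≟ᴱ 0ᴱ
    ... | no ≢0 = coeffʸ-keep j ≢0 u
    ... | yes ≡0 = trans (coeffʸ-vanishes j support
                          (All.map (λ ≢0 → λ { refl → ≢0 ≡0 }) (keep-nonzero u)))
                         (sym ≡0)

  open Support using (support; coeffʸ-support; keep-nonzero)

  coeffʸ-one≢0 : ∀ k → coeffʸ k one ≢ 0ᴱ → k ≡ 0ℤ
  coeffʸ-one≢0 k one≢0 with 0ℤ ≟ k
  ... | yes 0≡k = sym 0≡k
  ... | no _    = ⊥-elim (one≢0 refl)

  UnitTimesPowerOfY : LPoly → Set
  UnitTimesPowerOfY u = Σ ℤ λ d → IsSignedPowerOfω (coeffʸ d u) × (∀ j → d ≢ j → coeffʸ j u ≡ 0ᴱ)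

  coeffʸ-0-one : coeffʸ 0ℤ one ≡ 1ᴱ
  coeffʸ-0-one = refl

  product-extremes : ∀ t₁ r₁ t₂ r₂ →
    All (λ t → coeffʸ (yExp t) (t₁ ∷ r₁) ≢ 0ᴱ) (t₁ ∷ r₁) →
    All (λ t → coeffʸ (yExp t) (t₂ ∷ r₂) ≢ 0ᴱ) (t₂ ∷ r₂) →
    (∀ k → coeffʸ k ((t₁ ∷ r₁) ⊗ (t₂ ∷ r₂)) ≡ coeffʸ k one) →
    Σ ℤ λ d → IsSignedPowerOfω (coeffʸ d (t₁ ∷ r₁)) × All (λ t → yExp t ≡ d) (t₁ ∷ r₁)
  product-extremes t₁ r₁ t₂ r₂ (nz₁ ∷ nzs₁) (nz₂ ∷ nzs₂) pq≡one = d₁ , unit , concentrated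
    where
    p = t₁ ∷ r₁
    q = t₂ ∷ r₂
    d₁ d₂ e₁ e₂ : ℤ
    d₁ = yExp (argmax yExp t₁ r₁)
    d₂ = yExp (argmax yExp t₂ r₂)
    e₁ = yExp (argmin yExp t₁ r₁)
    e₂ = yExp (argmin yExp t₂ r₂)
    ≤d₁ = below-argmax t₁ r₁
    ≤d₂ = below-argmax t₂ r₂
    e₁≤ = above-argmin t₁ r₁
    e₂≤ = above-argmin t₂ r₂
    top : coeffʸ (d₁ + d₂) (p ⊗ q) ≡ coeffʸ d₁ p *ᴱ coeffʸ d₂ q
    top = coeffʸ-⊗-extreme {_≤_} p q d₁ d₂ separated-≤ ≤d₁ ≤d₂
    bottom : coeffʸ (e₁ + e₂) (p ⊗ q) ≡ coeffʸ e₁ p *ᴱ coeffʸ e₂ q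
    bottom = coeffʸ-⊗-extreme {λ x y → y ≤ x} p q e₁ e₂ separated-≥ e₁≤ e₂≤
    exponents-cancel : ∀ {x₁ x₂} → coeffʸ x₁ p ≢ 0ᴱ → coeffʸ x₂ q ≢ 0ᴱ →
      coeffʸ (x₁ + x₂) (p ⊗ q) ≡ coeffʸ x₁ p *ᴱ coeffʸ x₂ q → x₁ + x₂ ≡ 0ℤ
    exponents-cancel {x₁} {x₂} p≢0 q≢0 product = coeffʸ-one≢0 (x₁ + x₂) λ one≡0 →
      [ p≢0 , q≢0 ]′ (x*ᴱy≡0⇒x≡0∨y≡0 (coeffʸ x₁ p) (coeffʸ x₂ q)
                                       (trans (sym product) (trans (pq≡one (x₁ + x₂)) one≡0)))
    d₁+d₂≡0 : d₁ + d₂ ≡ 0ℤ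
    d₁+d₂≡0 = exponents-cancel (argmax-all yExp nz₁ nzs₁) (argmax-all yExp nz₂ nzs₂) top
    e₁+e₂≡0 : e₁ + e₂ ≡ 0ℤ
    e₁+e₂≡0 = exponents-cancel (argmin-all yExp nz₁ nzs₁) (argmin-all yExp nz₂ nzs₂) bottom
    e₁≡d₁ : e₁ ≡ d₁
    e₁≡d₁ = separated-≤ (ℤ.≤-trans (All.head e₁≤) (All.head ≤d₁))
                        (ℤ.≤-trans (All.head e₂≤) (All.head ≤d₂))
                        (trans e₁+e₂≡0 (sym d₁+d₂≡0))
    unit : IsSignedPowerOfω (coeffʸ d₁ p)
    unit = unit⇒signedPowerOfω (coeffʸ d₁ p) (coeffʸ d₂ q)
      (trans (sym top) (trans (pq≡one (d₁ + d₂)) (cong (λ k → coeffʸ k one) d₁+d₂≡0)))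
    concentrated : All (λ t → yExp t ≡ d₁) p
    concentrated = All.zipWith (λ (≤d , e≤) → ℤ.≤-antisym ≤d (subst (_≤ _) e₁≡d₁ e≤)) (≤d₁ , e₁≤)

  -- Restricting u and v to the terms in nonzero slices makes the extreme exponents of the lists
  -- those of the slices.
  units-of-slices : ∀ u v → (∀ k → coeffʸ k (u ⊗ v) ≡ coeffʸ k one) → UnitTimesPowerOfY u
  units-of-slices u v uv≡one =
    from-supports (support u) (support v) (coeffʸ-support u) (coeffʸ-support v) (keep-nonzero u u) (keep-nonzero v v)
    where
    nonzero-at : ∀ w' w → (∀ j → coeffʸ j w' ≡ coeffʸ j w) → ∀ {xs} →
      All (λ t → coeffʸ (yExp t) w ≢ 0ᴱ) xs → All (λ t → coeffʸ (yExp t) w' ≢ 0ᴱ) xs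
    nonzero-at w' w w'≗w =
      All.map {P = λ t → coeffʸ (yExp t) w ≢ 0ᴱ} λ {t} w≢0 w'≡0 → w≢0 (trans (sym (w'≗w (yExp t))) w'≡0)
    from-supports : ∀ p q → (∀ j → coeffʸ j p ≡ coeffʸ j u) → (∀ j → coeffʸ j q ≡ coeffʸ j v) →
      All (λ t → coeffʸ (yExp t) u ≢ 0ᴱ) p → All (λ t → coeffʸ (yExp t) v ≢ 0ᴱ) q → UnitTimesPowerOfY u
    from-supports [] q p≗u q≗v _ _ = ⊥-elim (0ᴱ≢1ᴱ
      (trans (sym empty) (trans (coeffʸ-⊗-cong [] u q v p≗u q≗v 0ℤ) (trans (uv≡one 0ℤ) coeffʸ-0-one))))
      where
      empty : coeffʸ 0ℤ ([] ⊗ q) ≡ 0ᴱ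
      empty = refl
    from-supports p@(_ ∷ _) [] p≗u q≗v _ _ = ⊥-elim (0ᴱ≢1ᴱ
      (trans (sym empty) (trans (coeffʸ-⊗-cong p u [] v p≗u q≗v 0ℤ) (trans (uv≡one 0ℤ) coeffʸ-0-one))))
      where
      empty : coeffʸ 0ℤ (p ⊗ []) ≡ 0ᴱ
      empty = cong (coeffʸ 0ℤ) (⊗-[] p)
    from-supports p@(t₁ ∷ r₁) q@(t₂ ∷ r₂) p≗u q≗v nz₁ nz₂ =
      from-extremes (product-extremes t₁ r₁ t₂ r₂ (nonzero-at p u p≗u nz₁) (nonzero-at q v q≗v nz₂)
                                      (λ k → trans (coeffʸ-⊗-cong p u q v p≗u q≗v k) (uv≡one k)))
      where
      from-extremes : Σ ℤ (λ d → IsSignedPowerOfω (coeffʸ d p) × All (λ t → yExp t ≡ d) p) → UnitTimesPowerOfY u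
      from-extremes (d , unit , concentrated) = d , subst IsSignedPowerOfω (p≗u d) unit , λ j d≢j →
        trans (sym (p≗u j)) (coeffʸ-vanishes j p (All.map (λ t≡d t≡j → d≢j (trans (sym t≡d) t≡j)) concentrated))

module Infinite (m : ℕ∞) (ξ ξ⁻¹ : 𝔼) (ξ*ξ⁻¹≡1 : ξ *ᴱ ξ⁻¹ ≡ 1ᴱ) where
  open Laurent ξ ξ⁻¹ ξ*ξ⁻¹≡1
  open Quotient m ∞

  coeff-reduced-at : ∀ z b i j → coeff (reduced z b) i j ≡ coeff (reduced (if ⌊ b ≟ j ⌋ then z else 0ᴱ) j) i j
  coeff-reduced-at z b i j = by-cases (b ≟ j)
    where
    by-cases : (b≟j : Dec (b ≡ j)) → coeff (reduced z b) i j ≡ coeff (reduced (if ⌊ b≟j ⌋ then z else 0ᴱ) j) i j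
    by-cases (yes b≡j) = cong (λ b → coeff (reduced z b) i j) b≡j
    by-cases (no b≢j)  = trans (cong₂ (λ x y → x + (y + 0ℤ))
                                      (termCoeff-miss (re z) 0ℤ b i j (λ (_ , b≡j) → b≢j b≡j))
                                      (termCoeff-miss (im z) 1ℤ b i j (λ (_ , b≡j) → b≢j b≡j)))
                               (sym (coeff-reduced-0ᴱ j i j))

  -- ℤ[ξ][y^±] written back with x-degrees 0 and 1
  normalʸ : LPoly → LPoly
  normalʸ = concatMap (λ t → reduced (value t) (yExp t))

  coeff-normalʸ : ∀ w i j → coeff (normalʸ w) i j ≡ coeff (reduced (coeffʸ j w) j) i j
  coeff-normalʸ [] i j = sym (coeff-reduced-0ᴱ j i j)
  coeff-normalʸ (t@(c , a , b) ∷ w) i j = begin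
    coeff (reduced (c · ξ^ a) b ++ normalʸ w) i j
      ≡⟨ coeff-++ (reduced (c · ξ^ a) b) (normalʸ w) i j ⟩
    coeff (reduced (c · ξ^ a) b) i j + coeff (normalʸ w) i j
      ≡⟨ cong₂ _+_ (trans (coeff-reduced-at (c · ξ^ a) b i j)
                          (cong (λ z → coeff (reduced z j) i j) (at-slice ⌊ b ≟ j ⌋)))
                   (coeff-normalʸ w i j) ⟩
    coeff (reduced (valueAt j t) j) i j + coeff (reduced (coeffʸ j w) j) i j
      ≡⟨ coeff-++ (reduced (valueAt j t) j) (reduced (coeffʸ j w) j) i j ⟨
    coeff (reduced (valueAt j t) j ++ reduced (coeffʸ j w) j) i j
      ≡⟨ coeff-reduced-+ᴱ (valueAt j t) (coeffʸ j w) j i j ⟩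
    coeff (reduced (coeffʸ j (t ∷ w)) j) i j ∎
    where
    open ≡-Reasoning
    at-slice : ∀ h → (if h then c · ξ^ a else 0ᴱ) ≡ c · (if h then ξ^ a else 0ᴱ)
    at-slice true  = refl
    at-slice false = sym (·-zeroʳ c)

  module Presentation (coeffʸ-ψX : ∀ j → coeffʸ j (ψX m) ≡ 0ᴱ)
                      (reduce : ∀ c a b → monomial c a b ∼ reduced (c · ξ^ a) b) where

    coeffʸ-∼ : ∀ {f g} → f ∼ g → ∀ k → coeffʸ k f ≡ coeffʸ k g
    coeffʸ-∼ f∼g k = eval-∼ (atY k) kills-ψX kills-ψY f∼g
      where
      kills-ψX : ∀ A → coeffʸ k (A ⊗ ψX m) ≡ 0ᴱ
      kills-ψX A = trans (coeffʸ-⊗ A (ψX m) k)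
        (trans (sumᴱ-cong A (λ t → trans (cong (value t *ᴱ_) (coeffʸ-ψX (k - yExp t))) (*ᴱ-zeroʳ (value t))))
               (sumᴱ-zero A))
      kills-ψY : ∀ B → coeffʸ k (B ⊗ ψY ∞) ≡ 0ᴱ
      kills-ψY B = cong (coeffʸ k) (⊗-[] B)

    coeffʸ-injective : ∀ {f g} → (∀ k → coeffʸ k f ≡ coeffʸ k g) → f ∼ g
    coeffʸ-injective {f} {g} f≗g = by-ideal (∼-vanishing⇒InIdeal
      (∼-concatMap (λ t → reduced (value t) (yExp t)) (λ (c , a , b) → reduce c a b) (f ⊕ (⊖ g)))
      (λ i j → trans (coeff-normalʸ (f ⊕ (⊖ g)) i j)
                 (trans (cong (λ z → coeff (reduced z j) i j) (difference-vanishes j)) (coeff-reduced-0ᴱ j i j))))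
      where
      difference-vanishes : ∀ j → coeffʸ j (f ⊕ (⊖ g)) ≡ 0ᴱ
      difference-vanishes j = trans (eval-⊕⊖ (atY j) f g)
        (trans (cong (_+ᴱ -ᴱ coeffʸ j g) (f≗g j)) (+ᴱ-inverseʳ (coeffʸ j g)))

    unit-slices : ∀ u → IsUnit m ∞ u → UnitTimesPowerOfY u
    unit-slices u (v , uv≈1) = units-of-slices u v (coeffʸ-∼ {u ⊗ v} {one} (by-ideal uv≈1))

    concentrated⇒monomial : ∀ u s a d → coeffʸ d u ≡ s · ξ^ a → (∀ j → d ≢ j → coeffʸ j u ≡ 0ᴱ) →
      u ∼ monomial s a d
    concentrated⇒monomial u s a d at-d elsewhere = coeffʸ-injective slices
      where
      slices : ∀ j → coeffʸ j u ≡ coeffʸ j (monomial s a d)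
      slices j with d ≟ j
      ... | yes refl = trans at-d (sym (+ᴱ-identityʳ (s · ξ^ a)))
      ... | no d≢j   = trans (elsewhere j d≢j) (sym (trans (+ᴱ-identityʳ (s · 0ᴱ)) (·-zeroʳ s)))

module Case₃∞ where
  open Laurent ω ω̄ refl
  open Quotient (fin 3) ∞

  coeffʸ-ψX : ∀ j → coeffʸ j (ψX (fin 3)) ≡ 0ᴱ
  coeffʸ-ψX j with 0ℤ ≟ j
  ... | yes _ = refl
  ... | no _  = refl

  open Infinite (fin 3) ω ω̄ refl
  open Presentation coeffʸ-ψX (XReduction₃.reduce ∞)

  isUnit⇒signedMonomial : ∀ u → IsUnit (fin 3) ∞ u → IsSignedMonomial (fin 3) ∞ u
  isUnit⇒signedMonomial u u-unit = from-slices (unit-slices u u-unit)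
    where
    from-slices : UnitTimesPowerOfY u → IsSignedMonomial (fin 3) ∞ u
    from-slices (d , (s , k , s-sign , at-d) , elsewhere) =
      s , + toℕ k , d , s-sign , difference∈I (concentrated⇒monomial u s (+ toℕ k) d at-d elsewhere)

module Case₂∞ where
  open Laurent -1ᴱ -1ᴱ refl
  open Quotient (fin 2) ∞

  coeffʸ-ψX : ∀ j → coeffʸ j (ψX (fin 2)) ≡ 0ᴱ
  coeffʸ-ψX j with 0ℤ ≟ j
  ... | yes _ = refl
  ... | no _  = refl

  im-^ : ∀ n → im (-1ᴱ ^ n) ≡ 0ℤ
  im-^ zero    = refl
  im-^ (suc n) with -1ᴱ ^ n | im-^ n
  ... | x +ω y | refl = refl

  im-ξ^ : ∀ a → im (ξ^ a) ≡ 0ℤ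
  im-ξ^ (+ n)       = im-^ n
  im-ξ^ ℤ.-[1+ n ]  = im-^ (suc n)

  reduce : ∀ c a b → monomial c a b ∼ reduced (c · ξ^ a) b
  reduce c a b = ∼-trans (XReduction₂.reduce ∞ c a b) (≗ᶜ⇒∼ λ i j → sym (trans
    (cong (λ y → coeff ((re (c · ξ^ a) , 0ℤ , b) ∷ (y , 1ℤ , b) ∷ []) i j)
          (trans (cong (λ k → c * k) (im-ξ^ a)) (ℤ.*-zeroʳ c)))
    (cong (λ k → termCoeff (re (c · ξ^ a) , 0ℤ , b) i j + k) (coeff-∷-zero 1ℤ b [] i j))))

  open Infinite (fin 2) -1ᴱ -1ᴱ refl
  open Presentation coeffʸ-ψX reduce

  im-coeffʸ : ∀ j w → im (coeffʸ j w) ≡ 0ℤ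
  im-coeffʸ j [] = refl
  im-coeffʸ j ((c , a , b) ∷ w) = cong₂ _+_ (trans (cong (λ k → c * k) (im-at ⌊ b ≟ j ⌋)) (ℤ.*-zeroʳ c)) (im-coeffʸ j w)
    where
    im-at : ∀ h → im (if h then ξ^ a else 0ᴱ) ≡ 0ℤ
    im-at true  = im-ξ^ a
    im-at false = refl

  isUnit⇒signedMonomial : ∀ u → IsUnit (fin 2) ∞ u → IsSignedMonomial (fin 2) ∞ u
  isUnit⇒signedMonomial u u-unit = from-slices (unit-slices u u-unit)
    where
    nonreal : ∀ {s} (k : Fin 2) → IsSign s → im (s · ω ^ toℕ (suc k)) ≢ 0ℤ
    nonreal zero       (inj₁ refl) ()
    nonreal zero       (inj₂ refl) ()
    nonreal (suc zero) (inj₁ refl) ()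
    nonreal (suc zero) (inj₂ refl) ()
    from-slices : UnitTimesPowerOfY u → IsSignedMonomial (fin 2) ∞ u
    from-slices (d , (s , zero , s-sign , at-d) , elsewhere) =
      s , 0ℤ , d , s-sign , difference∈I (concentrated⇒monomial u s 0ℤ d at-d elsewhere)
    from-slices (d , (s , suc k , s-sign , at-d) , _) =
      ⊥-elim (nonreal k s-sign (trans (cong im (sym at-d)) (im-coeffʸ d u)))

lemma2p25 : (m n : ℕ∞) → Admissible m n → (u : LPoly) →
    IsUnit m n u ⇔
      (Σ ℤ λ s → Σ ℤ λ i → Σ ℤ λ j →
        (s ≡ 1ℤ ⊎ s ≡ -1ℤ) × (u ≈[ m , n ] monomial s i j))
lemma2p25 m n admissible u = mk⇔ (isUnit⇒signedMonomial admissible) (signedMonomial⇒isUnit m n u)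
  where
  isUnit⇒signedMonomial : Admissible m n → IsUnit m n u → IsSignedMonomial m n u
  isUnit⇒signedMonomial (inj₁ refl , inj₁ refl) = Case₂₃.isUnit⇒signedMonomial u
  isUnit⇒signedMonomial (inj₁ refl , inj₂ refl) = Case₂∞.isUnit⇒signedMonomial u
  isUnit⇒signedMonomial (inj₂ refl , inj₁ refl) = Case₃₃.isUnit⇒signedMonomial u
  isUnit⇒signedMonomial (inj₂ refl , inj₂ refl) = Case₃∞.isUnit⇒signedMonomial u
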